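{- Let $w\in S_n$ and $w'\in S_k$, and let $w''\in S_{n+k}$ have one-line notation $w'(1)+n,\dots,w'(k)+n,w(1),\dots,w(n)$. If $\mathrm{supp}(\mathfrak G_w)=\{\mathrm{wt}(\mathcal D):\mathcal D\in\mathcal{SBD}(D(w),\emptyset,A)\}$ and $\mathrm{supp}(\mathfrak G_{w'})=\{\mathrm{wt}(\mathcal D):\mathcal D\in\mathcal{SBD}(D(w'),\emptyset,A')\}$ for some $A\subseteq D(w)$ and $A'\subseteq D(w')$, then there exists $A''\subseteq D(w'')$ such that $\mathrm{supp}(\mathfrak G_{w''})=\{\mathrm{wt}(\mathcal D):\mathcal D\in\mathcal{SBD}(D(w''),\emptyset,A'')\}$.
   Context: Grothendieck polynomials: for $w\in S_N$, $\mathfrak G_{w_0}=x_1^{N-1}\cdots x_{N-1}$ for $w_0=N\,(N-1)\cdots1$, and $\mathfrak G_w=\partial_i((1-x_{i+1})\mathfrak G_{ws_i})$ whenever $w(i)<w(i+1)$ ($ws_i$ swaps entries in positions $i,i+1$; $\partial_if=(f-s_if)/(x_i-x_{i+1})$). Support = set of exponent vectors with nonzero coefficient. For $w\in S_N$, diagrams are subsets of $[N]\times[N]$, $(i,j)$ in row $i$ (top to bottom) and column $j$; $\mathrm{wt}(D)_i$ = number of squares in row $i$; Rothe diagram $D(w)=\{(i,j):i<w^{ -1}(j),\ j<w(i)\}$. A dead square diagram is a triple $(D,F,A)$ with $F\subseteq D$, $A\subseteq D\setminus F$, such that for every $(i,j)\in F$ there is $(i',j)\in A$ with $i'<i$ and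 no $(i'',j)\in D\setminus F$ with $i'<i''<i$. If $(i,j)\in D\setminus F$ and $(i-1,j)\notin D$, a bubbling move yields $(D\setminus\{(i,j)\}\cup\{(i-1,j)\},F,A_0)$ with $A_0=A$ if $(i,j)\notin A$ and $A_0=A\setminus\{(i,j)\}\cup\{(i-1,j)\}$ otherwise. If $(i,j)\in A$ and $(i-1,j)\notin D$, a K-bubbling move yields $(D\cup\{(i-1,j)\},F\cup\{(i,j)\},A\setminus\{(i,j)\}\cup\{(i-1,j)\})$. $\mathcal{SBD}(D,F,A)$ is the set of dead square diagrams obtainable from $(D,F,A)$ by finitely many (possibly zero) such moves; $\mathrm{wt}((D',F',A'))=\mathrm{wt}(D')$. -}

module Defs where

open import Data.Nat as ℕ using (ℕ; zero; suc; _∸_)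
open import Data.Integer as ℤ using (ℤ)
open import Data.Fin as Fin using (Fin; toℕ)
import Data.Fin.Properties as FinP
open import Data.Fin.Permutation using (Permutation′; _⟨$⟩ʳ_; _⟨$⟩ˡ_)
open import Data.Fin.Permutation.Components using (transpose)
open import Data.Vec as Vec using (Vec; tabulate; lookup; zipWith; replicate)
open import Data.Vec.Properties using (≡-dec)
open import Data.List as List using (List; []; _∷_; _++_)
open import Data.Nat.ListAction using (sum)
open import Data.Product using (Σ; ∃; _×_; _,_)
open import Data.Bool using (Bool; true; false; if_then_else_; _∧_)
open import Relation.Nullary using (¬_; does)
open import Relation.Nullary.Decidable using (⌊_⌋)
open import Relation.Binary.PropositionalEquality using (_≡_; _≢_)
open import Relation.Binary.Construct.Closure.ReflexiveTransitive using (Star)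
open import Function.Bundles using (_⇔_)

-- Conventions: everything is 0-indexed.  Position/row/column p : Fin N
-- stands for the paper's index toℕ p + 1.  For a permutation w of [N],
-- w ⟨$⟩ʳ p is w(p) (0-indexed) and w ⟨$⟩ˡ p is w⁻¹(p).

-- Polynomials in x_1..x_N with integer coefficients, as finite formal
-- sums of terms  c · x^a  (a an exponent vector).  Two polynomials are
-- equal when all their coefficients agree.

Monomial : ℕ → Set
Monomial N = Vec ℕ N

Poly : ℕ → Set
Poly N = List (ℤ × Monomial N)

coeff : ∀ {N} → Poly N → Monomial N → ℤ
coeff [] a = ℤ.0ℤ
coeff ((c , b) ∷ f) a =
  if does (≡-dec ℕ._≟_ b a) then c ℤ.+ coeff f a else coeff f a

infix 4 _≈ₚ_
_≈ₚ_ : ∀ {N} → Poly N → Poly N → Set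
f ≈ₚ g = ∀ a → coeff f a ≡ coeff g a

infixl 6 _+ₚ_ _-ₚ_
infixl 7 _*ₚ_

_+ₚ_ : ∀ {N} → Poly N → Poly N → Poly N
f +ₚ g = f ++ g

-ₚ_ : ∀ {N} → Poly N → Poly N
-ₚ f = List.map (λ { (c , a) → (ℤ.- c , a) }) f

_-ₚ_ : ∀ {N} → Poly N → Poly N → Poly N
f -ₚ g = f +ₚ (-ₚ g)

_*ₚ_ : ∀ {N} → Poly N → Poly N → Poly N
f *ₚ g = List.concatMap
  (λ { (c , a) → List.map (λ { (d , b) → (c ℤ.* d , zipWith ℕ._+_ a b) }) g }) f

1ₚ : ∀ {N} → Poly N
1ₚ = (ℤ.1ℤ , replicate _ 0) ∷ []

X : ∀ {N} → Fin N → Poly N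
X i = (ℤ.1ℤ , tabulate (λ k → if does (k FinP.≟ i) then 1 else 0)) ∷ []

swapVars : ∀ {N} → Fin N → Fin N → Poly N → Poly N
swapVars i j f =
  List.map (λ { (c , a) → (c , tabulate (λ k → lookup a (transpose i j k))) }) f

topMonomial : ∀ N → Poly N
topMonomial N = (ℤ.1ℤ , tabulate (λ i → N ∸ suc (toℕ i))) ∷ []

-- Grothendieck polynomials, following the recursive definition:
-- Groth w f  means  "f is (a representative of) 𝔊_w obtained by the
-- recursion".  ∂_i h is given as the polynomial g with
-- (x_i − x_{i+1}) g = h − s_i h.

data Groth {N : ℕ} : Permutation′ N → Poly N → Set where
  -- w = w₀ = N (N-1) ⋯ 1 :  w(i) = N+1-i (1-indexed)
  top  : (w : Permutation′ N) →
         (∀ i → toℕ (w ⟨$⟩ʳ i) ℕ.+ toℕ i ℕ.+ 1 ≡ N) →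
         Groth w (topMonomial N)
  -- w(i) < w(i+1), v = w s_i, f = 𝔊_v, g = ∂_i((1 − x_{i+1}) f)
  step : (w v : Permutation′ N) (i j : Fin N) →
         toℕ j ≡ suc (toℕ i) →
         w ⟨$⟩ʳ i Fin.< w ⟨$⟩ʳ j →
         (∀ k → v ⟨$⟩ʳ k ≡ w ⟨$⟩ʳ (transpose i j k)) →
         (f g : Poly N) → Groth v f →
         (X i -ₚ X j) *ₚ g ≈ₚ
           ((1ₚ -ₚ X j) *ₚ f) -ₚ swapVars i j ((1ₚ -ₚ X j) *ₚ f) →
         Groth w g

SuppGrothIs : ∀ {N} → Permutation′ N → (Monomial N → Set) → Set
SuppGrothIs w S = ∀ f → Groth w f → ∀ a → (coeff f a ≢ ℤ.0ℤ) ⇔ S a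

-- Diagrams: subsets of [N] × [N]; D r c = true iff (r , c) ∈ D
-- (r = row, top to bottom; c = column).

Diagram : ℕ → Set
Diagram N = Fin N → Fin N → Bool

∅ᴰ : ∀ {N} → Diagram N
∅ᴰ _ _ = false

infix 4 _⊆ᴰ_
_⊆ᴰ_ : ∀ {N} → Diagram N → Diagram N → Set
A ⊆ᴰ D = ∀ r c → A r c ≡ true → D r c ≡ true

setSq : ∀ {N} → Fin N → Fin N → Bool → Diagram N → Diagram N
setSq r c b D r' c' =
  if does (r' FinP.≟ r) ∧ does (c' FinP.≟ c) then b else D r' c'

wt : ∀ {N} → Diagram N → Vec ℕ N
wt {N} D = tabulate (λ r →
  sum (List.map (λ c → if D r c then 1 else 0) (List.allFin N)))

Rothe : ∀ {N} → Permutation′ N → Diagram N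
Rothe w r c = ⌊ r FinP.<? (w ⟨$⟩ˡ c) ⌋ ∧ ⌊ c FinP.<? (w ⟨$⟩ʳ r) ⌋

record Triple (N : ℕ) : Set where
  constructor ⟨_,_,_⟩
  field
    D F A : Diagram N

IsDSD : ∀ {N} → Triple N → Set
IsDSD ⟨ D , F , A ⟩ =
  (F ⊆ᴰ D) ×
  (∀ r c → A r c ≡ true → D r c ≡ true × F r c ≡ false) ×
  (∀ r c → F r c ≡ true →
     ∃ λ r' → r' Fin.< r × A r' c ≡ true ×
       (∀ r'' → r' Fin.< r'' → r'' Fin.< r →
          ¬ (D r'' c ≡ true × F r'' c ≡ false)))

-- one move (bubbling or K-bubbling) applied to a dead square diagram;
-- the square (s , c) moves to / spawns (r , c) with r the row above s.
data Move {N : ℕ} : Triple N → Triple N → Set where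
  bubble  : ∀ {D F A} (r s c : Fin N) → toℕ s ≡ suc (toℕ r) →
            IsDSD ⟨ D , F , A ⟩ →
            D s c ≡ true → F s c ≡ false → D r c ≡ false →
            Move ⟨ D , F , A ⟩
                 ⟨ setSq r c true (setSq s c false D) , F ,
                   (if A s c then setSq r c true (setSq s c false A) else A) ⟩
  kbubble : ∀ {D F A} (r s c : Fin N) → toℕ s ≡ suc (toℕ r) →
            IsDSD ⟨ D , F , A ⟩ →
            A s c ≡ true → D r c ≡ false →
            Move ⟨ D , F , A ⟩
                 ⟨ setSq r c true D , setSq s c true F ,
                   setSq r c true (setSq s c false A) ⟩

_∈SBD_ : ∀ {N} → Triple N → Triple N → Set
t' ∈SBD t = Star Move t t' × IsDSD t'

SuppViaSBD : ∀ {N} → Permutation′ N → Diagram N → Set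
SuppViaSBD w A =
  SuppGrothIs w (λ a → ∃ λ t → (t ∈SBD ⟨ Rothe w , ∅ᴰ , A ⟩) × wt (Triple.D t) ≡ a)

-- Write w″ = w′ ⊖ w for the skew sum. Its Rothe diagram has a full k × n rectangle
-- followed by D(w′) on the first k rows, and D(w) on the last n rows. An ascent of w″
-- at adjacent positions always lies in one of these two blocks, so induction along the
-- recursion gives
--   𝔊_{w″} = (x₁⋯x_k)ⁿ · 𝔊_{w′}(x₁,…,x_k) · 𝔊_w(x_{k+1},…,x_{n+k}).
-- The recursion only pins down (x_i − x_{i+1}) · 𝔊_w, so the induction runs on
-- coefficient functions: multiplication by x_i − x_j is injective, and divided
-- differences of polynomials exist, which provides the factors 𝔊_{w′} and 𝔊_w.
-- On the diagram side, no bubbling or K-bubbling move touches the full rectangle or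
-- leaves a block, and the dead-square condition holds blockwise. So with A″ made of A′
-- in the upper block and A in the lower block, the weights in 𝒮ℬ𝒟(D(w″), ∅, A″) are
-- the (n + a′, a) with a′, a weights in the two blocks, matching the support above.

module Submission where

open import Defs
open import Data.Nat using (ℕ; _+_)
open import Data.Fin using (Fin; toℕ)
open import Data.Fin.Permutation using (Permutation′; _⟨$⟩ʳ_)
open import Data.Product using (∃; _×_)
open import Relation.Binary.PropositionalEquality using (_≡_)

open import Algebra.Bundles using (AbelianGroup)
open import Data.Nat using (zero; suc; pred; _∸_; _≤_; _<_; _≤?_; ≢-nonZero)
import Data.Nat.Properties as ℕP
open import Data.Nat.ListAction using (sum)
open import Data.Integer using (ℤ; 0ℤ; 1ℤ)
  renaming (_+_ to _+ᶻ_; _-_ to _-ᶻ_; _*_ to _*ᶻ_; -_ to -ᶻ_)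
import Data.Integer.Properties as ℤP
import Data.Integer.Solver as ℤ-Solver
import Data.Nat.Solver as ℕ-Solver
open import Algebra.Properties.Group (AbelianGroup.group ℤP.+-0-abelianGroup) using (∙-cancelʳ)
open import Data.Fin as Fin using (_↑ˡ_; _↑ʳ_; splitAt)
open import Data.Fin.Properties
  using (_≟_; _<?_; toℕ<n; toℕ-injective; toℕ-cast; toℕ-↑ˡ; toℕ-↑ʳ; cast-involutive; ↑ˡ-injective; ↑ʳ-injective;
         splitAt-↑ˡ; splitAt-↑ʳ; splitAt⁻¹-↑ˡ; splitAt⁻¹-↑ʳ; all?)
open import Data.Fin.Permutation as Perm using (_⟨$⟩ˡ_; _∘ₚ_)
open import Data.Fin.Permutation.Components using (transpose)
open import Data.Vec as Vec using (Vec; lookup; tabulate; zipWith; replicate; updateAt; _[_]≔_)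
import Data.Vec.Properties as VP
open import Data.Vec.Properties using (≡-dec; tabulate∘lookup; lookup∘tabulate; lookup-zipWith; zipWith-replicate₁; map-id;
               updateAt-updateAt; updateAt-id; updateAt-id-local; lookup∘updateAt; lookup∘updateAt′;
               lookup∘update; lookup∘update′; lookup-cast; lookup-++ˡ; lookup-++ʳ; lookup-map)
open import Data.List as List using ([]; _∷_; _++_; map; concatMap)
import Data.List.Properties as LP
open import Data.Product using (∃₂; _,_; proj₁; proj₂)
open import Data.Sum using (_⊎_; inj₁; inj₂)
open import Data.Bool using (Bool; true; false; if_then_else_; _∧_)
import Data.Bool.Properties as BoolP
open import Data.Empty using (⊥-elim)
open import Function using (_∘_; _∘′_)
open import Function.Bundles using (_⇔_; mk⇔; Equivalence)
open import Relation.Nullary using (¬_; Dec; yes; no; does)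
open import Relation.Nullary.Decidable using (⌊_⌋; isYes≗does; does-⇔; dec-true; dec-false)
open import Relation.Binary.PropositionalEquality
  using (_≢_; refl; sym; trans; cong; cong₂; subst; subst₂; _≗_; module ≡-Reasoning)
open import Relation.Binary.Construct.Closure.ReflexiveTransitive using (Star; ε; _◅_; _◅◅_)
open ≡-Reasoning

lookup-ext : ∀ {A : Set} {N} {a b : Vec A N} → (∀ r → lookup a r ≡ lookup b r) → a ≡ b
lookup-ext {a = a} {b} eq =
  trans (sym (tabulate∘lookup a)) (trans (VP.tabulate-cong eq) (tabulate∘lookup b))

module _ {A : Set} {N} (i j : Fin N) (i≢j : i ≢ j) where

  lookup-ext₃ : {a b : Vec A N} → lookup a i ≡ lookup b i → lookup a j ≡ lookup b j →
                (∀ r → r ≢ i → r ≢ j → lookup a r ≡ lookup b r) → a ≡ b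
  lookup-ext₃ {a} {b} at-i at-j elsewhere = lookup-ext at
    where
    at : ∀ r → lookup a r ≡ lookup b r
    at r with r ≟ i | r ≟ j
    ... | yes refl | _        = at-i
    ... | no _     | yes refl = at-j
    ... | no r≢i   | no r≢j   = elsewhere r r≢i r≢j

transpose-at-i : ∀ {N} (i j : Fin N) → transpose i j i ≡ j
transpose-at-i i j rewrite dec-true (i ≟ i) refl = refl

transpose-at-j : ∀ {N} (i j : Fin N) → transpose i j j ≡ i
transpose-at-j i j with j ≟ i
... | yes refl = refl
... | no _ rewrite dec-true (j ≟ j) refl = refl

transpose-elsewhere : ∀ {N} (i j r : Fin N) → r ≢ i → r ≢ j → transpose i j r ≡ r
transpose-elsewhere i j r r≢i r≢j rewrite dec-false (r ≟ i) r≢i | dec-false (r ≟ j) r≢j = refl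

transpose-involutive : ∀ {N} (i j r : Fin N) → transpose i j (transpose i j r) ≡ r
transpose-involutive i j r = by-cases (r ≟ i) (r ≟ j)
  where
  by-cases : Dec (r ≡ i) → Dec (r ≡ j) → transpose i j (transpose i j r) ≡ r
  by-cases (yes refl) _ = trans (cong (transpose r j) (transpose-at-i r j)) (transpose-at-j r j)
  by-cases (no _) (yes refl) = trans (cong (transpose i r) (transpose-at-j i r)) (transpose-at-i i r)
  by-cases (no r≢i) (no r≢j) =
    trans (cong (transpose i j) (transpose-elsewhere i j r r≢i r≢j)) (transpose-elsewhere i j r r≢i r≢j)

module _ {M N} (e : Fin M → Fin N) (e-injective : ∀ {a b} → e a ≡ e b → a ≡ b) (i i′ : Fin M) where

  transpose-embed : ∀ j → transpose (e i) (e i′) (e j) ≡ e (transpose i i′ j)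
  transpose-embed j = by-cases (j ≟ i) (j ≟ i′)
    where
    by-cases : Dec (j ≡ i) → Dec (j ≡ i′) → transpose (e i) (e i′) (e j) ≡ e (transpose i i′ j)
    by-cases (yes refl) _ = trans (transpose-at-i (e j) (e i′)) (cong e (sym (transpose-at-i j i′)))
    by-cases (no _) (yes refl) = trans (transpose-at-j (e i) (e j)) (cong e (sym (transpose-at-j i j)))
    by-cases (no j≢i) (no j≢i′) =
      trans (transpose-elsewhere (e i) (e i′) (e j) (j≢i ∘′ e-injective) (j≢i′ ∘′ e-injective))
            (cong e (sym (transpose-elsewhere i i′ j j≢i j≢i′)))

transpose-outside : ∀ {M N} (e : Fin M → Fin N) (i i′ : Fin M) r → (∀ j → e j ≢ r) → transpose (e i) (e i′) r ≡ r
transpose-outside e i i′ r outside =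
  transpose-elsewhere (e i) (e i′) r (λ r≡ → outside i (sym r≡)) (λ r≡ → outside i′ (sym r≡))

unit : ∀ {N} → Fin N → Monomial N
unit i = tabulate (λ r → if does (r ≟ i) then 1 else 0)

inc dec : ∀ {N} → Fin N → Monomial N → Monomial N
inc i b = updateAt b i suc
dec i x = updateAt x i pred

module _ {N} (i : Fin N) where

  lookup-inc : ∀ b → lookup (inc i b) i ≡ suc (lookup b i)
  lookup-inc b = lookup∘updateAt i b

  lookup-inc′ : ∀ {r} → r ≢ i → ∀ b → lookup (inc i b) r ≡ lookup b r
  lookup-inc′ {r} r≢i b = lookup∘updateAt′ r i r≢i b

  lookup-dec : ∀ x → lookup (dec i x) i ≡ pred (lookup x i)
  lookup-dec x = lookup∘updateAt i x

  lookup-dec′ : ∀ {r} → r ≢ i → ∀ x → lookup (dec i x) r ≡ lookup x r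
  lookup-dec′ {r} r≢i x = lookup∘updateAt′ r i r≢i x

  lookup-dec-≤ : ∀ x r → lookup (dec i x) r ≤ lookup x r
  lookup-dec-≤ x r with r ≟ i
  ... | yes refl = subst (_≤ lookup x r) (sym (lookup-dec x)) (ℕP.pred[n]≤n {lookup x r})
  ... | no r≢i   = ℕP.≤-reflexive (lookup-dec′ r≢i x)

  unit+≡inc : ∀ b → zipWith _+_ (unit i) b ≡ inc i b
  unit+≡inc b = lookup-ext at
    where
    at : ∀ r → lookup (zipWith _+_ (unit i) b) r ≡ lookup (inc i b) r
    at r rewrite lookup-zipWith _+_ r (unit i) b
               | lookup∘tabulate (λ r → if does (r ≟ i) then 1 else 0) r with r ≟ i
    ... | yes refl = sym (lookup-inc b)
    ... | no r≢i   = sym (lookup-inc′ r≢i b)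

  dec-inc : ∀ b → dec i (inc i b) ≡ b
  dec-inc b = trans (updateAt-updateAt i b) (updateAt-id i b)

  inc-dec : ∀ x {m} → lookup x i ≡ suc m → inc i (dec i x) ≡ x
  inc-dec x eq = trans (updateAt-updateAt i x) (updateAt-id-local i x (trans (cong (suc ∘ pred) eq) (sym eq)))

  inc-injective : ∀ {a b} → inc i a ≡ inc i b → a ≡ b
  inc-injective {a} {b} eq = trans (sym (dec-inc a)) (trans (cong (dec i) eq) (dec-inc b))

  inc≢ : ∀ {x} → lookup x i ≡ 0 → ∀ b → inc i b ≢ x
  inc≢ x₀ b refl with trans (sym (lookup-inc b)) x₀
  ... | ()

  data IncView : Monomial N → Set where
    zeroAt : ∀ {x} → lookup x i ≡ 0 → IncView x
    incOf  : ∀ b → IncView (inc i b)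

  incView : ∀ x → IncView x
  incView x with lookup x i in eq
  ... | zero  = zeroAt eq
  ... | suc _ = subst IncView (inc-dec x eq) (incOf (dec i x))

0+≡id : ∀ {N} (b : Monomial N) → zipWith _+_ (replicate N 0) b ≡ b
0+≡id b = trans (zipWith-replicate₁ _+_ 0 b) (map-id b)

swapExp : ∀ {N} → Fin N → Fin N → Monomial N → Monomial N
swapExp i j a = tabulate (λ r → lookup a (transpose i j r))

module _ {N} (i j : Fin N) where

  lookup-swapExp : ∀ a r → lookup (swapExp i j a) r ≡ lookup a (transpose i j r)
  lookup-swapExp a r = lookup∘tabulate _ r

  swapExp-involutive : ∀ a → swapExp i j (swapExp i j a) ≡ a
  swapExp-involutive a = lookup-ext λ r →
    trans (lookup-swapExp (swapExp i j a) r)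
          (trans (lookup-swapExp a (transpose i j r)) (cong (lookup a) (transpose-involutive i j r)))

  swapExp-injective : ∀ {a b} → swapExp i j a ≡ swapExp i j b → a ≡ b
  swapExp-injective {a} {b} eq =
    trans (sym (swapExp-involutive a)) (trans (cong (swapExp i j) eq) (swapExp-involutive b))

module _ where
  open ℤ-Solver.+-*-Solver using (solve; _:+_; _:-_; :-_; _:*_; _:=_)

  sub-of-sums : ∀ a b c d → (a +ᶻ b) -ᶻ (c +ᶻ d) ≡ (a -ᶻ c) +ᶻ (b -ᶻ d)
  sub-of-sums = solve 4 (λ a b c d → (a :+ b) :- (c :+ d) := (a :- c) :+ (b :- d)) refl

  telescope : ∀ a b c → (a -ᶻ b) +ᶻ (c -ᶻ a) ≡ c -ᶻ b
  telescope = solve 3 (λ a b c → (a :- b) :+ (c :- a) := c :- b) refl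

  neg-sub-neg : ∀ a b → (-ᶻ a) -ᶻ (-ᶻ b) ≡ b -ᶻ a
  neg-sub-neg = solve 2 (λ a b → (:- a) :- (:- b) := b :- a) refl

  *-distribʳ-sub : ∀ a b c → (a -ᶻ b) *ᶻ c ≡ a *ᶻ c -ᶻ b *ᶻ c
  *-distribʳ-sub = solve 3 (λ a b c → (a :- b) :* c := a :* c :- b :* c) refl

  *-distribˡ-sub : ∀ a b c → a *ᶻ (b -ᶻ c) ≡ a *ᶻ b -ᶻ a *ᶻ c
  *-distribˡ-sub = solve 3 (λ a b c → a :* (b :- c) := a :* b :- a :* c) refl

Coeffs : ℕ → Set
Coeffs N = Monomial N → ℤ

termCoeff : ∀ {N} → ℤ → Monomial N → Coeffs N
termCoeff c b a = if does (≡-dec ℕP._≟_ b a) then c else 0ℤ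

termCoeff-≢ : ∀ {N} c {b a : Monomial N} → b ≢ a → termCoeff c b a ≡ 0ℤ
termCoeff-≢ c {b} {a} b≢a with ≡-dec ℕP._≟_ b a
... | yes b≡a = ⊥-elim (b≢a b≡a)
... | no _    = refl

termCoeff-neg : ∀ {N} c (b : Monomial N) x → termCoeff (-ᶻ c) b x ≡ -ᶻ termCoeff c b x
termCoeff-neg c b x with does (≡-dec ℕP._≟_ b x)
... | true  = refl
... | false = refl

termCoeff-swapExp : ∀ {N} (i j : Fin N) c a x → termCoeff c (swapExp i j a) x ≡ termCoeff c a (swapExp i j x)
termCoeff-swapExp i j c a x with ≡-dec ℕP._≟_ (swapExp i j a) x | ≡-dec ℕP._≟_ a (swapExp i j x)
... | yes _  | yes _  = refl
... | yes sa≡ | no a≢ = ⊥-elim (a≢ (trans (sym (swapExp-involutive i j a)) (cong (swapExp i j) sa≡)))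
... | no sa≢ | yes a≡ = ⊥-elim (sa≢ (trans (cong (swapExp i j) a≡) (swapExp-involutive i j x)))
... | no _   | no _   = refl

coeff-∷ : ∀ {N} c b (f : Poly N) a → coeff ((c , b) ∷ f) a ≡ termCoeff c b a +ᶻ coeff f a
coeff-∷ c b f a with does (≡-dec ℕP._≟_ b a)
... | true  = refl
... | false = sym (ℤP.+-identityˡ _)

coeff-++ : ∀ {N} (f g : Poly N) a → coeff (f ++ g) a ≡ coeff f a +ᶻ coeff g a
coeff-++ []             g a = sym (ℤP.+-identityˡ _)
coeff-++ ((c , b) ∷ f) g a = begin
  coeff ((c , b) ∷ f ++ g) a                       ≡⟨ coeff-∷ c b (f ++ g) a ⟩
  termCoeff c b a +ᶻ coeff (f ++ g) a              ≡⟨ cong (termCoeff c b a +ᶻ_) (coeff-++ f g a) ⟩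
  termCoeff c b a +ᶻ (coeff f a +ᶻ coeff g a)      ≡⟨ ℤP.+-assoc (termCoeff c b a) (coeff f a) (coeff g a) ⟨
  (termCoeff c b a +ᶻ coeff f a) +ᶻ coeff g a      ≡⟨ cong (_+ᶻ coeff g a) (coeff-∷ c b f a) ⟨
  coeff ((c , b) ∷ f) a +ᶻ coeff g a               ∎

coeff-neg : ∀ {N} (f : Poly N) a → coeff (-ₚ f) a ≡ -ᶻ coeff f a
coeff-neg []             a = refl
coeff-neg ((c , b) ∷ f) a with does (≡-dec ℕP._≟_ b a)
... | true  = trans (cong (-ᶻ c +ᶻ_) (coeff-neg f a)) (sym (ℤP.neg-distrib-+ c _))
... | false = coeff-neg f a

module _ {M N} (c : ℤ) (m : Monomial M → Monomial N) (m-injective : ∀ {a b} → m a ≡ m b → a ≡ b)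
         (h : ℤ × Monomial M → ℤ × Monomial N) (h-def : ∀ d b → h (d , b) ≡ (c *ᶻ d , m b)) where

  coeff-map-image : ∀ g b → coeff (map h g) (m b) ≡ c *ᶻ coeff g b
  coeff-map-image []              b = sym (ℤP.*-zeroʳ c)
  coeff-map-image ((d , b′) ∷ g) b rewrite h-def d b′
    with ≡-dec ℕP._≟_ (m b′) (m b) | ≡-dec ℕP._≟_ b′ b
  ... | yes _    | yes _    = trans (cong (c *ᶻ d +ᶻ_) (coeff-map-image g b)) (sym (ℤP.*-distribˡ-+ c d _))
  ... | yes mb≡  | no b≢    = ⊥-elim (b≢ (m-injective mb≡))
  ... | no mb≢   | yes b≡   = ⊥-elim (mb≢ (cong m b≡))
  ... | no _     | no _     = coeff-map-image g b

  coeff-map-outside : ∀ g a → (∀ b → m b ≢ a) → coeff (map h g) a ≡ 0ℤ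
  coeff-map-outside []              a _       = refl
  coeff-map-outside ((d , b′) ∷ g) a outside rewrite h-def d b′ with ≡-dec ℕP._≟_ (m b′) a
  ... | yes mb≡ = ⊥-elim (outside b′ mb≡)
  ... | no _    = coeff-map-outside g a outside

whenPositive : ℕ → ℤ → ℤ
whenPositive zero    _ = 0ℤ
whenPositive (suc _) v = v

whenPositive-0 : ∀ m → whenPositive m 0ℤ ≡ 0ℤ
whenPositive-0 zero    = refl
whenPositive-0 (suc _) = refl

whenPositive-* : ∀ m c v → whenPositive m (c *ᶻ v) ≡ c *ᶻ whenPositive m v
whenPositive-* zero    c v = sym (ℤP.*-zeroʳ c)
whenPositive-* (suc _) c v = refl

-- The coefficients of x_i · f in terms of those of f; the guard is needed because
-- `dec` truncates at 0.
xMul : ∀ {N} → Fin N → Coeffs N → Coeffs N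
xMul i φ x = whenPositive (lookup x i) (φ (dec i x))

module _ {N} (i : Fin N) (φ : Coeffs N) where

  xMul-inc : ∀ b → xMul i φ (inc i b) ≡ φ b
  xMul-inc b rewrite lookup-inc i b | dec-inc i b = refl

  xMul-zero : ∀ {x} → lookup x i ≡ 0 → xMul i φ x ≡ 0ℤ
  xMul-zero x₀ rewrite x₀ = refl

  xMul-suc : ∀ {x m} → lookup x i ≡ suc m → xMul i φ x ≡ φ (dec i x)
  xMul-suc xₛ rewrite xₛ = refl

  xMul-cong : ∀ {χ} → φ ≗ χ → xMul i φ ≗ xMul i χ
  xMul-cong φ≗χ x = cong (whenPositive (lookup x i)) (φ≗χ (dec i x))

coeff-X*ₚ : ∀ {N} c (i : Fin N) g x → coeff (((c , unit i) ∷ []) *ₚ g) x ≡ c *ᶻ xMul i (coeff g) x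
coeff-X*ₚ {N} c i g x = trans (coeff-++ (map h g) [] x) (trans (ℤP.+-identityʳ _) (by-view (incView i x)))
  where
  h : ℤ × Monomial N → ℤ × Monomial N
  h t = c *ᶻ proj₁ t , zipWith _+_ (unit i) (proj₂ t)
  h-def : ∀ d b → h (d , b) ≡ (c *ᶻ d , inc i b)
  h-def d b = cong (c *ᶻ d ,_) (unit+≡inc i b)
  by-view : ∀ {x} → IncView i x → coeff (map h g) x ≡ c *ᶻ xMul i (coeff g) x
  by-view (zeroAt x₀) = begin
    coeff (map h g) _             ≡⟨ coeff-map-outside c (inc i) (inc-injective i) h h-def g _ (inc≢ i x₀) ⟩
    0ℤ                            ≡⟨ ℤP.*-zeroʳ c ⟨
    c *ᶻ 0ℤ                       ≡⟨ cong (c *ᶻ_) (xMul-zero i (coeff g) x₀) ⟨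
    c *ᶻ xMul i (coeff g) _       ∎
  by-view (incOf b) = begin
    coeff (map h g) (inc i b)     ≡⟨ coeff-map-image c (inc i) (inc-injective i) h h-def g b ⟩
    c *ᶻ coeff g b                ≡⟨ cong (c *ᶻ_) (xMul-inc i (coeff g) b) ⟨
    c *ᶻ xMul i (coeff g) (inc i b) ∎

coeff-1*ₚ : ∀ {N} c (g : Poly N) x → coeff (((c , replicate N 0) ∷ []) *ₚ g) x ≡ c *ᶻ coeff g x
coeff-1*ₚ {N} c g x =
  trans (coeff-++ (map h g) [] x) (trans (ℤP.+-identityʳ _) (coeff-map-image c (λ b → b) (λ eq → eq) h h-def g x))
  where
  h : ℤ × Monomial N → ℤ × Monomial N
  h t = c *ᶻ proj₁ t , zipWith _+_ (replicate N 0) (proj₂ t)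
  h-def : ∀ d b → h (d , b) ≡ (c *ᶻ d , b)
  h-def d b = cong (c *ᶻ d ,_) (0+≡id b)

coeff-∷*ₚ : ∀ {N} t (f g : Poly N) x → coeff ((t ∷ f) *ₚ g) x ≡ coeff ((t ∷ []) *ₚ g) x +ᶻ coeff (f *ₚ g) x
coeff-∷*ₚ {N} (c , e) f g x =
  trans (coeff-++ (map h g) (f *ₚ g) x)
        (cong (_+ᶻ coeff (f *ₚ g) x) (sym (trans (coeff-++ (map h g) [] x) (ℤP.+-identityʳ (coeff (map h g) x)))))
  where
  h : ℤ × Monomial N → ℤ × Monomial N
  h t = c *ᶻ proj₁ t , zipWith _+_ e (proj₂ t)

diffMul : ∀ {N} → Fin N → Fin N → Coeffs N → Coeffs N
diffMul i j ψ x = xMul i ψ x -ᶻ xMul j ψ x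

oneMinusXMul : ∀ {N} → Fin N → Coeffs N → Coeffs N
oneMinusXMul j φ x = φ x -ᶻ xMul j φ x

antisymmetrize : ∀ {N} → Fin N → Fin N → Coeffs N → Coeffs N
antisymmetrize i j φ x = φ x -ᶻ φ (swapExp i j x)

stepNumerator : ∀ {N} → Fin N → Fin N → Coeffs N → Coeffs N
stepNumerator i j φ = antisymmetrize i j (oneMinusXMul j φ)

stepNumerator-cong : ∀ {N} (i j : Fin N) {φ χ} → φ ≗ χ → stepNumerator i j φ ≗ stepNumerator i j χ
stepNumerator-cong i j φ≗χ x =
  cong₂ _-ᶻ_ (cong₂ _-ᶻ_ (φ≗χ x) (xMul-cong j _ φ≗χ x))
             (cong₂ _-ᶻ_ (φ≗χ (swapExp i j x)) (xMul-cong j _ φ≗χ (swapExp i j x)))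

module _ {N} (i j : Fin N) where

  coeff-[Xi-Xj]*ₚ : ∀ g x → coeff ((X i -ₚ X j) *ₚ g) x ≡ diffMul i j (coeff g) x
  coeff-[Xi-Xj]*ₚ g x =
    trans (coeff-∷*ₚ (1ℤ , unit i) ((-ᶻ 1ℤ , unit j) ∷ []) g x)
      (cong₂ _+ᶻ_ (trans (coeff-X*ₚ 1ℤ i g x) (ℤP.*-identityˡ _))
                  (trans (coeff-X*ₚ (-ᶻ 1ℤ) j g x) (ℤP.-1*i≡-i _)))

  coeff-[1-Xj]*ₚ : ∀ f x → coeff ((1ₚ -ₚ X j) *ₚ f) x ≡ oneMinusXMul j (coeff f) x
  coeff-[1-Xj]*ₚ f x =
    trans (coeff-∷*ₚ (1ℤ , replicate N 0) ((-ᶻ 1ℤ , unit j) ∷ []) f x)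
      (cong₂ _+ᶻ_ (trans (coeff-1*ₚ 1ℤ f x) (ℤP.*-identityˡ _))
                  (trans (coeff-X*ₚ (-ᶻ 1ℤ) j f x) (ℤP.-1*i≡-i _)))

  coeff-swapVars : ∀ h x → coeff (swapVars i j h) x ≡ coeff h (swapExp i j x)
  coeff-swapVars h x = begin
    coeff (swapVars i j h) x                         ≡⟨ cong (coeff (swapVars i j h)) (swapExp-involutive i j x) ⟨
    coeff (swapVars i j h) (swapExp i j (swapExp i j x))
      ≡⟨ coeff-map-image 1ℤ (swapExp i j) (swapExp-injective i j) _ h-def h (swapExp i j x) ⟩
    1ℤ *ᶻ coeff h (swapExp i j x)                    ≡⟨ ℤP.*-identityˡ _ ⟩
    coeff h (swapExp i j x)                          ∎
    where
    h-def : ∀ d b → (d , swapExp i j b) ≡ (1ℤ *ᶻ d , swapExp i j b)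
    h-def d b = cong (_, swapExp i j b) (sym (ℤP.*-identityˡ d))

  coeff-[1-s]ₚ : ∀ h x → coeff (h -ₚ swapVars i j h) x ≡ antisymmetrize i j (coeff h) x
  coeff-[1-s]ₚ h x =
    trans (coeff-++ h _ x) (cong (coeff h x +ᶻ_) (trans (coeff-neg (swapVars i j h) x) (cong -ᶻ_ (coeff-swapVars h x))))

  stepEquation⇒coeffs : ∀ f g →
    (X i -ₚ X j) *ₚ g ≈ₚ ((1ₚ -ₚ X j) *ₚ f) -ₚ swapVars i j ((1ₚ -ₚ X j) *ₚ f) →
    diffMul i j (coeff g) ≗ stepNumerator i j (coeff f)
  stepEquation⇒coeffs f g eq x = begin
    diffMul i j (coeff g) x                               ≡⟨ coeff-[Xi-Xj]*ₚ g x ⟨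
    coeff ((X i -ₚ X j) *ₚ g) x                           ≡⟨ eq x ⟩
    coeff (((1ₚ -ₚ X j) *ₚ f) -ₚ swapVars i j ((1ₚ -ₚ X j) *ₚ f)) x
                                                          ≡⟨ coeff-[1-s]ₚ ((1ₚ -ₚ X j) *ₚ f) x ⟩
    antisymmetrize i j (coeff ((1ₚ -ₚ X j) *ₚ f)) x
      ≡⟨ cong₂ _-ᶻ_ (coeff-[1-Xj]*ₚ f x) (coeff-[1-Xj]*ₚ f (swapExp i j x)) ⟩
    stepNumerator i j (coeff f) x                         ∎

  -- φ at x is read off from (x_i − x_j) φ at x · x_i, up to a value of φ at a monomial
  -- with smaller x_j-exponent; induct on that exponent.
  diffMul-cancel : i ≢ j → ∀ {φ χ} → diffMul i j φ ≗ diffMul i j χ → φ ≗ χ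
  diffMul-cancel i≢j {φ} {χ} eq x = agree (lookup x j) x refl
    where
    agree : ∀ m x → lookup x j ≡ m → φ x ≡ χ x
    agree m x xⱼ = ∙-cancelʳ (-ᶻ xMul j φ (inc i x)) (φ x) (χ x) (begin
      φ x -ᶻ xMul j φ (inc i x)  ≡⟨ cong (_-ᶻ xMul j φ (inc i x)) (xMul-inc i φ x) ⟨
      diffMul i j φ (inc i x)    ≡⟨ eq (inc i x) ⟩
      diffMul i j χ (inc i x)    ≡⟨ cong₂ _-ᶻ_ (xMul-inc i χ x) (sym (below m xⱼ′)) ⟩
      χ x -ᶻ xMul j φ (inc i x)  ∎)
      where
      xⱼ′ : lookup (inc i x) j ≡ m
      xⱼ′ = trans (lookup-inc′ i (λ j≡i → i≢j (sym j≡i)) x) xⱼ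
      below : ∀ m → lookup (inc i x) j ≡ m → xMul j φ (inc i x) ≡ xMul j χ (inc i x)
      below zero    y₀ = trans (xMul-zero j φ y₀) (sym (xMul-zero j χ y₀))
      below (suc m) yₛ = trans (xMul-suc j φ yₛ)
        (trans (agree m (dec j (inc i x)) (trans (lookup-dec j (inc i x)) (cong pred yₛ))) (sym (xMul-suc j χ yₛ)))

module _ {N} (i : Fin N) where

  xMul-+ : ∀ φ χ x → xMul i (λ y → φ y +ᶻ χ y) x ≡ xMul i φ x +ᶻ xMul i χ x
  xMul-+ φ χ x with lookup x i
  ... | zero  = refl
  ... | suc _ = refl

  xMul-0 : ∀ x → xMul i (λ _ → 0ℤ) x ≡ 0ℤ
  xMul-0 x with lookup x i
  ... | zero  = refl
  ... | suc _ = refl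

  xMul-termCoeff : ∀ c b x → xMul i (termCoeff c b) x ≡ termCoeff c (inc i b) x
  xMul-termCoeff c b x = by-view (incView i x)
    where
    by-view : ∀ {x} → IncView i x → xMul i (termCoeff c b) x ≡ termCoeff c (inc i b) x
    by-view (zeroAt x₀) = trans (xMul-zero i (termCoeff c b) x₀) (sym (termCoeff-≢ c (inc≢ i x₀ b)))
    by-view (incOf b′) rewrite xMul-inc i (termCoeff c b) b′
      with ≡-dec ℕP._≟_ b b′ | ≡-dec ℕP._≟_ (inc i b) (inc i b′)
    ... | yes _  | yes _   = refl
    ... | yes b≡ | no ib≢  = ⊥-elim (ib≢ (cong (inc i) b≡))
    ... | no b≢  | yes ib≡ = ⊥-elim (b≢ (inc-injective i ib≡))
    ... | no _   | no _    = refl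

module _ {N} (i j : Fin N) where

  diffMul-coeff-[] : ∀ x → diffMul i j (coeff {N} []) x ≡ 0ℤ
  diffMul-coeff-[] x rewrite xMul-0 i x | xMul-0 j x = refl

  diffMul-coeff-++ : ∀ f g x → diffMul i j (coeff (f ++ g)) x ≡ diffMul i j (coeff f) x +ᶻ diffMul i j (coeff g) x
  diffMul-coeff-++ f g x = begin
    diffMul i j (coeff (f ++ g)) x
      ≡⟨ cong₂ _-ᶻ_ (xMul-cong i _ (coeff-++ f g) x) (xMul-cong j _ (coeff-++ f g) x) ⟩
    xMul i (λ y → coeff f y +ᶻ coeff g y) x -ᶻ xMul j (λ y → coeff f y +ᶻ coeff g y) x
      ≡⟨ cong₂ _-ᶻ_ (xMul-+ i (coeff f) (coeff g) x) (xMul-+ j (coeff f) (coeff g) x) ⟩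
    (xMul i (coeff f) x +ᶻ xMul i (coeff g) x) -ᶻ (xMul j (coeff f) x +ᶻ xMul j (coeff g) x)
      ≡⟨ sub-of-sums (xMul i (coeff f) x) (xMul i (coeff g) x) (xMul j (coeff f) x) (xMul j (coeff g) x) ⟩
    diffMul i j (coeff f) x +ᶻ diffMul i j (coeff g) x ∎

  diffMul-coeff-∷ : ∀ c b f x → diffMul i j (coeff ((c , b) ∷ f)) x ≡
                    (termCoeff c (inc i b) x -ᶻ termCoeff c (inc j b) x) +ᶻ diffMul i j (coeff f) x
  diffMul-coeff-∷ c b f x = begin
    diffMul i j (coeff ((c , b) ∷ f)) x
      ≡⟨ cong₂ _-ᶻ_ (xMul-cong i _ (coeff-∷ c b f) x) (xMul-cong j _ (coeff-∷ c b f) x) ⟩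
    xMul i (λ y → termCoeff c b y +ᶻ coeff f y) x -ᶻ xMul j (λ y → termCoeff c b y +ᶻ coeff f y) x
      ≡⟨ cong₂ _-ᶻ_ (xMul-+ i (termCoeff c b) (coeff f) x) (xMul-+ j (termCoeff c b) (coeff f) x) ⟩
    (xMul i (termCoeff c b) x +ᶻ xMul i (coeff f) x) -ᶻ (xMul j (termCoeff c b) x +ᶻ xMul j (coeff f) x)
      ≡⟨ sub-of-sums (xMul i (termCoeff c b) x) (xMul i (coeff f) x)
                     (xMul j (termCoeff c b) x) (xMul j (coeff f) x) ⟩
    (xMul i (termCoeff c b) x -ᶻ xMul j (termCoeff c b) x) +ᶻ diffMul i j (coeff f) x
      ≡⟨ cong (_+ᶻ diffMul i j (coeff f) x) (cong₂ _-ᶻ_ (xMul-termCoeff i c b x) (xMul-termCoeff j c b x)) ⟩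
    (termCoeff c (inc i b) x -ᶻ termCoeff c (inc j b) x) +ᶻ diffMul i j (coeff f) x ∎

module DividedDifference {N} (i j : Fin N) (i≢j : i ≢ j) where

  private
    j≢i : j ≢ i
    j≢i j≡i = i≢j (sym j≡i)

  setExp : Monomial N → ℕ → ℕ → Monomial N
  setExp a u v = (a [ i ]≔ u) [ j ]≔ v

  lookup-setExp-i : ∀ a u v → lookup (setExp a u v) i ≡ u
  lookup-setExp-i a u v = trans (lookup∘update′ i≢j (a [ i ]≔ u) v) (lookup∘update i a u)

  lookup-setExp-j : ∀ a u v → lookup (setExp a u v) j ≡ v
  lookup-setExp-j a u v = lookup∘update j (a [ i ]≔ u) v

  lookup-setExp-other : ∀ a u v r → r ≢ i → r ≢ j → lookup (setExp a u v) r ≡ lookup a r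
  lookup-setExp-other a u v r r≢i r≢j = trans (lookup∘update′ r≢j (a [ i ]≔ u) v) (lookup∘update′ r≢i a u)

  setExp-ext : ∀ {a u v} b → u ≡ lookup b i → v ≡ lookup b j → (∀ r → r ≢ i → r ≢ j → lookup a r ≡ lookup b r) →
               setExp a u v ≡ b
  setExp-ext {a} {u} {v} b at-i at-j elsewhere = lookup-ext₃ i j i≢j
    (trans (lookup-setExp-i a u v) at-i) (trans (lookup-setExp-j a u v) at-j)
    (λ r r≢i r≢j → trans (lookup-setExp-other a u v r r≢i r≢j) (elsewhere r r≢i r≢j))

  inc-i-setExp : ∀ a u v → inc i (setExp a u v) ≡ setExp a (suc u) v
  inc-i-setExp a u v = sym (setExp-ext (inc i s)
    (sym (trans (lookup-inc i s) (cong suc (lookup-setExp-i a u v))))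
    (sym (trans (lookup-inc′ i j≢i s) (lookup-setExp-j a u v)))
    (λ r r≢i r≢j → sym (trans (lookup-inc′ i r≢i s) (lookup-setExp-other a u v r r≢i r≢j))))
    where s = setExp a u v

  inc-j-setExp : ∀ a u v → inc j (setExp a u v) ≡ setExp a u (suc v)
  inc-j-setExp a u v = sym (setExp-ext (inc j s)
    (sym (trans (lookup-inc′ j i≢j s) (lookup-setExp-i a u v)))
    (sym (trans (lookup-inc j s) (cong suc (lookup-setExp-j a u v))))
    (λ r r≢i r≢j → sym (trans (lookup-inc′ j r≢j s) (lookup-setExp-other a u v r r≢i r≢j))))
    where s = setExp a u v

  setExp-self : ∀ a → setExp a (lookup a i) (lookup a j) ≡ a
  setExp-self a = setExp-ext a refl refl (λ _ _ _ → refl)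

  setExp-swapped : ∀ a → setExp a (lookup a j) (lookup a i) ≡ swapExp i j a
  setExp-swapped a = setExp-ext (swapExp i j a)
    (sym (trans (lookup-swapExp i j a i) (cong (lookup a) (transpose-at-i i j))))
    (sym (trans (lookup-swapExp i j a j) (cong (lookup a) (transpose-at-j i j))))
    (λ r r≢i r≢j → sym (trans (lookup-swapExp i j a r) (cong (lookup a) (transpose-elsewhere i j r r≢i r≢j))))

  -- ladder c a u v m = Σ_{t<m} c x^{a[i ↦ u+t, j ↦ v+m-1-t]}; multiplied by x_i − x_j it
  -- telescopes to c (x^{a[i ↦ u+m, j ↦ v]} − x^{a[i ↦ u, j ↦ v+m]}).
  ladder : ℤ → Monomial N → ℕ → ℕ → ℕ → Poly N
  ladder c a u v zero    = []
  ladder c a u v (suc m) = (c , setExp a u (v + m)) ∷ ladder c a (suc u) v m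

  diffMul-ladder : ∀ c a m u v x → diffMul i j (coeff (ladder c a u v m)) x ≡
                   termCoeff c (setExp a (u + m) v) x -ᶻ termCoeff c (setExp a u (v + m)) x
  diffMul-ladder c a zero u v x rewrite ℕP.+-identityʳ u | ℕP.+-identityʳ v =
    trans (diffMul-coeff-[] i j x) (sym (ℤP.+-inverseʳ (termCoeff c (setExp a u v) x)))
  diffMul-ladder c a (suc m) u v x = begin
    diffMul i j (coeff (ladder c a u v (suc m))) x
      ≡⟨ diffMul-coeff-∷ i j c (setExp a u (v + m)) (ladder c a (suc u) v m) x ⟩
    (T (inc i (setExp a u (v + m))) -ᶻ T (inc j (setExp a u (v + m))))
      +ᶻ diffMul i j (coeff (ladder c a (suc u) v m)) x
      ≡⟨ cong₂ _+ᶻ_ (cong₂ (λ p q → T p -ᶻ T q) (inc-i-setExp a u (v + m)) (inc-j-setExp a u (v + m)))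
                    (diffMul-ladder c a m (suc u) v x) ⟩
    (T (setExp a (suc u) (v + m)) -ᶻ T (setExp a u (suc (v + m))))
      +ᶻ (T (setExp a (suc u + m) v) -ᶻ T (setExp a (suc u) (v + m)))
      ≡⟨ telescope (T (setExp a (suc u) (v + m))) (T (setExp a u (suc (v + m)))) (T (setExp a (suc u + m) v)) ⟩
    T (setExp a (suc u + m) v) -ᶻ T (setExp a u (suc (v + m)))
      ≡⟨ cong₂ (λ p q → T (setExp a p v) -ᶻ T (setExp a u q)) (ℕP.+-suc u m) (ℕP.+-suc v m) ⟨
    T (setExp a (u + suc m) v) -ᶻ T (setExp a u (v + suc m)) ∎
    where
    T : Monomial N → ℤ
    T b = termCoeff c b x

  divDiffTerm : ℤ → Monomial N → Poly N
  divDiffTerm c a with lookup a j ≤? lookup a i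
  ... | yes _ = ladder c a (lookup a j) (lookup a j) (lookup a i ∸ lookup a j)
  ... | no _  = ladder (-ᶻ c) a (lookup a i) (lookup a i) (lookup a j ∸ lookup a i)

  diffMul-divDiffTerm : ∀ c a x → diffMul i j (coeff (divDiffTerm c a)) x ≡
                        termCoeff c a x -ᶻ termCoeff c (swapExp i j a) x
  diffMul-divDiffTerm c a x with lookup a j ≤? lookup a i
  ... | yes aⱼ≤aᵢ rewrite diffMul-ladder c a (lookup a i ∸ lookup a j) (lookup a j) (lookup a j) x
                        | ℕP.m+[n∸m]≡n aⱼ≤aᵢ | setExp-self a | setExp-swapped a = refl
  ... | no aⱼ≰aᵢ rewrite diffMul-ladder (-ᶻ c) a (lookup a j ∸ lookup a i) (lookup a i) (lookup a i) x
                       | ℕP.m+[n∸m]≡n (ℕP.<⇒≤ (ℕP.≰⇒> aⱼ≰aᵢ)) | setExp-self a | setExp-swapped a =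
    trans (cong₂ _-ᶻ_ (termCoeff-neg c (swapExp i j a) x) (termCoeff-neg c a x))
          (neg-sub-neg (termCoeff c (swapExp i j a) x) (termCoeff c a x))

  divDiff : Poly N → Poly N
  divDiff = concatMap (λ t → divDiffTerm (proj₁ t) (proj₂ t))

  diffMul-divDiff : ∀ h x → diffMul i j (coeff (divDiff h)) x ≡ antisymmetrize i j (coeff h) x
  diffMul-divDiff []             x = diffMul-coeff-[] i j x
  diffMul-divDiff ((c , a) ∷ h) x = begin
    diffMul i j (coeff (divDiffTerm c a ++ divDiff h)) x
      ≡⟨ diffMul-coeff-++ i j (divDiffTerm c a) (divDiff h) x ⟩
    diffMul i j (coeff (divDiffTerm c a)) x +ᶻ diffMul i j (coeff (divDiff h)) x
      ≡⟨ cong₂ _+ᶻ_ (diffMul-divDiffTerm c a x) (diffMul-divDiff h x) ⟩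
    (T x -ᶻ termCoeff c (swapExp i j a) x) +ᶻ (coeff h x -ᶻ coeff h x′)
      ≡⟨ cong (λ z → (T x -ᶻ z) +ᶻ (coeff h x -ᶻ coeff h x′)) (termCoeff-swapExp i j c a x) ⟩
    (T x -ᶻ T x′) +ᶻ (coeff h x -ᶻ coeff h x′)
      ≡⟨ sub-of-sums (T x) (coeff h x) (T x′) (coeff h x′) ⟨
    (T x +ᶻ coeff h x) -ᶻ (T x′ +ᶻ coeff h x′)
      ≡⟨ cong₂ _-ᶻ_ (coeff-∷ c a h x) (coeff-∷ c a h x′) ⟨
    antisymmetrize i j (coeff ((c , a) ∷ h)) x ∎
    where
    x′ : Monomial N
    x′ = swapExp i j x
    T : Coeffs N
    T = termCoeff c a

  divDiff-spec : ∀ h → (X i -ₚ X j) *ₚ divDiff h ≈ₚ h -ₚ swapVars i j h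
  divDiff-spec h x = trans (coeff-[Xi-Xj]*ₚ i j (divDiff h) x) (trans (diffMul-divDiff h x) (sym (coeff-[1-s]ₚ i j h x)))

record Intertwines {M N} (e : Fin M → Fin N) (P : Coeffs M → Coeffs N) : Set where
  field
    P-cong : ∀ {φ χ} → φ ≗ χ → P φ ≗ P χ
    P-sub  : ∀ φ χ → P (λ y → φ y -ᶻ χ y) ≗ (λ x → P φ x -ᶻ P χ x)
    P-xMul : ∀ i φ → xMul (e i) (P φ) ≗ P (xMul i φ)
    P-swap : ∀ i i′ φ x → P φ (swapExp (e i) (e i′) x) ≡ P (λ y → φ (swapExp i i′ y)) x

  diffMul-P : ∀ i i′ φ → diffMul (e i) (e i′) (P φ) ≗ P (diffMul i i′ φ)
  diffMul-P i i′ φ x = trans (cong₂ _-ᶻ_ (P-xMul i φ x) (P-xMul i′ φ x)) (sym (P-sub (xMul i φ) (xMul i′ φ) x))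

  oneMinusXMul-P : ∀ j φ → oneMinusXMul (e j) (P φ) ≗ P (oneMinusXMul j φ)
  oneMinusXMul-P j φ x = trans (cong (λ z → P φ x -ᶻ z) (P-xMul j φ x)) (sym (P-sub φ (xMul j φ) x))

  stepNumerator-P : ∀ i i′ φ → stepNumerator (e i) (e i′) (P φ) ≗ P (stepNumerator i i′ φ)
  stepNumerator-P i i′ φ x = begin
    stepNumerator (e i) (e i′) (P φ) x
      ≡⟨ cong₂ _-ᶻ_ (oneMinusXMul-P i′ φ x) (oneMinusXMul-P i′ φ (swapExp (e i) (e i′) x)) ⟩
    P ψ x -ᶻ P ψ (swapExp (e i) (e i′) x)          ≡⟨ cong (λ z → P ψ x -ᶻ z) (P-swap i i′ ψ x) ⟩
    P ψ x -ᶻ P (λ y → ψ (swapExp i i′ y)) x        ≡⟨ P-sub ψ (λ y → ψ (swapExp i i′ y)) x ⟨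
    P (stepNumerator i i′ φ) x                     ∎
    where
    ψ : Coeffs M
    ψ = oneMinusXMul i′ φ

  transport-step : ∀ {i i′} → e i ≢ e i′ → ∀ {f g : Poly N} {φ ψ : Coeffs M} →
    diffMul (e i) (e i′) (coeff g) ≗ stepNumerator (e i) (e i′) (coeff f) →
    coeff f ≗ P φ → diffMul i i′ ψ ≗ stepNumerator i i′ φ → coeff g ≗ P ψ
  transport-step {i} {i′} eᵢ≢eᵢ′ {f} {g} {φ} {ψ} g-step f≗Pφ ψ-step = diffMul-cancel (e i) (e i′) eᵢ≢eᵢ′ λ x → begin
    diffMul (e i) (e i′) (coeff g) x          ≡⟨ g-step x ⟩
    stepNumerator (e i) (e i′) (coeff f) x    ≡⟨ stepNumerator-cong (e i) (e i′) f≗Pφ x ⟩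
    stepNumerator (e i) (e i′) (P φ) x        ≡⟨ stepNumerator-P i i′ φ x ⟩
    P (stepNumerator i i′ φ) x                ≡⟨ P-cong ψ-step x ⟨
    P (diffMul i i′ ψ) x                      ≡⟨ diffMul-P i i′ ψ x ⟨
    diffMul (e i) (e i′) (P ψ) x              ∎

-- Variables and rows 1,…,k of a skew sum are `upper`, rows k+1,…,k+n are `lower`.
module SkewSum (n k : ℕ) where

  upper : Fin k → Fin (n + k)
  upper j = Fin.cast (ℕP.+-comm k n) (j ↑ˡ n)

  lower : Fin n → Fin (n + k)
  lower j = Fin.cast (ℕP.+-comm k n) (k ↑ʳ j)

  toℕ-upper : ∀ j → toℕ (upper j) ≡ toℕ j
  toℕ-upper j = trans (toℕ-cast _ (j ↑ˡ n)) (toℕ-↑ˡ j n)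

  toℕ-lower : ∀ j → toℕ (lower j) ≡ k + toℕ j
  toℕ-lower j = trans (toℕ-cast _ (k ↑ʳ j)) (toℕ-↑ʳ k j)

  upper-injective : ∀ {a b} → upper a ≡ upper b → a ≡ b
  upper-injective {a} {b} eq = toℕ-injective (trans (sym (toℕ-upper a)) (trans (cong toℕ eq) (toℕ-upper b)))

  lower-injective : ∀ {a b} → lower a ≡ lower b → a ≡ b
  lower-injective {a} {b} eq =
    toℕ-injective (ℕP.+-cancelˡ-≡ k _ _ (trans (sym (toℕ-lower a)) (trans (cong toℕ eq) (toℕ-lower b))))

  upper<lower : ∀ a b → toℕ (upper a) < toℕ (lower b)
  upper<lower a b = ℕP.<-≤-trans (subst (_< k) (sym (toℕ-upper a)) (toℕ<n a))
                                  (subst (k ≤_) (sym (toℕ-lower b)) (ℕP.m≤m+n k _))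

  upper≢lower : ∀ a b → upper a ≢ lower b
  upper≢lower a b eq = ℕP.<-irrefl (cong toℕ eq) (upper<lower a b)

  lower≢upper : ∀ a b → lower a ≢ upper b
  lower≢upper a b eq = upper≢lower b a (sym eq)

  adjacent-upper : ∀ {i i′} → toℕ (upper i′) ≡ suc (toℕ (upper i)) → toℕ i′ ≡ suc (toℕ i)
  adjacent-upper {i} {i′} eq = trans (sym (toℕ-upper i′)) (trans eq (cong suc (toℕ-upper i)))

  adjacent-lower : ∀ {i i′} → toℕ (lower i′) ≡ suc (toℕ (lower i)) → toℕ i′ ≡ suc (toℕ i)
  adjacent-lower {i} {i′} eq = ℕP.+-cancelˡ-≡ k _ _
    (trans (sym (toℕ-lower i′)) (trans eq (trans (cong suc (toℕ-lower i)) (sym (ℕP.+-suc k (toℕ i))))))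

  lower-upper-not-adjacent : ∀ {i i′} → toℕ (upper i′) ≢ suc (toℕ (lower i))
  lower-upper-not-adjacent {i} {i′} eq = ℕP.<-asym (upper<lower i′ i) (subst (toℕ (lower i) <_) (sym eq) (ℕP.n<1+n _))

  upper-mono-< : ∀ {a b} → a Fin.< b → upper a Fin.< upper b
  upper-mono-< {a} {b} a<b = subst₂ _<_ (sym (toℕ-upper a)) (sym (toℕ-upper b)) a<b

  upper-cancel-< : ∀ {a b} → upper a Fin.< upper b → a Fin.< b
  upper-cancel-< {a} {b} ua<ub = subst₂ _<_ (toℕ-upper a) (toℕ-upper b) ua<ub

  lower-mono-< : ∀ {a b} → a Fin.< b → lower a Fin.< lower b
  lower-mono-< {a} {b} a<b = subst₂ _<_ (sym (toℕ-lower a)) (sym (toℕ-lower b)) (ℕP.+-monoʳ-< k a<b)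

  lower-cancel-< : ∀ {a b} → lower a Fin.< lower b → a Fin.< b
  lower-cancel-< {a} {b} la<lb = ℕP.+-cancelˡ-< k _ _ (subst₂ _<_ (toℕ-lower a) (toℕ-lower b) la<lb)

  record IsSkewSum (w′ : Permutation′ k) (w : Permutation′ n) (w″ : Permutation′ (n + k)) : Set where
    field
      upper-value : ∀ j → toℕ (w″ ⟨$⟩ʳ upper j) ≡ toℕ (w′ ⟨$⟩ʳ j) + n
      lower-value : ∀ j → toℕ (w″ ⟨$⟩ʳ lower j) ≡ toℕ (w ⟨$⟩ʳ j)

  rowSplit : Fin (n + k) → Fin k ⊎ Fin n
  rowSplit p = splitAt k (Fin.cast (ℕP.+-comm n k) p)

  rowSplit-upper : ∀ j → rowSplit (upper j) ≡ inj₁ j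
  rowSplit-upper j = trans (cong (splitAt k) (cast-involutive (ℕP.+-comm n k) (ℕP.+-comm k n) (j ↑ˡ n))) (splitAt-↑ˡ k j n)

  rowSplit-lower : ∀ j → rowSplit (lower j) ≡ inj₂ j
  rowSplit-lower j = trans (cong (splitAt k) (cast-involutive (ℕP.+-comm n k) (ℕP.+-comm k n) (k ↑ʳ j))) (splitAt-↑ʳ k n j)

  data RowView : Fin (n + k) → Set where
    inUpper    : ∀ j → RowView (upper j)
    inLower : ∀ j → RowView (lower j)

  uncast : ∀ {p q} → q ≡ Fin.cast (ℕP.+-comm n k) p → Fin.cast (ℕP.+-comm k n) q ≡ p
  uncast {p} refl = cast-involutive (ℕP.+-comm k n) (ℕP.+-comm n k) p

  rowView : ∀ p → RowView p
  rowView p with rowSplit p in eq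
  ... | inj₁ j = subst RowView (uncast (splitAt⁻¹-↑ˡ eq)) (inUpper j)
  ... | inj₂ j = subst RowView (uncast (splitAt⁻¹-↑ʳ eq)) (inLower j)

  joinExp : Monomial k → Monomial n → Monomial (n + k)
  joinExp a′ a = Vec.cast (ℕP.+-comm k n) (Vec.map (n +_) a′ Vec.++ a)

  lookup-joinExp-upper : ∀ a′ a j → lookup (joinExp a′ a) (upper j) ≡ n + lookup a′ j
  lookup-joinExp-upper a′ a j =
    trans (lookup-cast (ℕP.+-comm k n) (Vec.map (n +_) a′ Vec.++ a) (j ↑ˡ n))
          (trans (lookup-++ˡ (Vec.map (n +_) a′) a j) (lookup-map j (n +_) a′))

  lookup-joinExp-lower : ∀ a′ a j → lookup (joinExp a′ a) (lower j) ≡ lookup a j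
  lookup-joinExp-lower a′ a j =
    trans (lookup-cast (ℕP.+-comm k n) (Vec.map (n +_) a′ Vec.++ a) (k ↑ʳ j)) (lookup-++ʳ (Vec.map (n +_) a′) a j)

  joinExp-ext : ∀ {x} a′ a → (∀ j → lookup x (upper j) ≡ n + lookup a′ j) → (∀ j → lookup x (lower j) ≡ lookup a j) →
                x ≡ joinExp a′ a
  joinExp-ext {x} a′ a at-upper at-lower = lookup-ext at
    where
    at : ∀ p → lookup x p ≡ lookup (joinExp a′ a) p
    at p with rowView p
    ... | inUpper j = trans (at-upper j) (sym (lookup-joinExp-upper a′ a j))
    ... | inLower j = trans (at-lower j) (sym (lookup-joinExp-lower a′ a j))

  joinExp-injective : ∀ {a′ a b′ b} → joinExp a′ a ≡ joinExp b′ b → a′ ≡ b′ × a ≡ b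
  joinExp-injective {a′} {a} {b′} {b} eq =
    lookup-ext (λ j → ℕP.+-cancelˡ-≡ n _ _
      (trans (sym (lookup-joinExp-upper a′ a j)) (trans (cong (λ x → lookup x (upper j)) eq) (lookup-joinExp-upper b′ b j)))) ,
    lookup-ext (λ j →
      trans (sym (lookup-joinExp-lower a′ a j)) (trans (cong (λ x → lookup x (lower j)) eq) (lookup-joinExp-lower b′ b j)))

  UpperDivisible : Monomial (n + k) → Set
  UpperDivisible x = ∀ j → n ≤ lookup x (upper j)

  upperDivisible? : ∀ x → Dec (UpperDivisible x)
  upperDivisible? x = all? (λ j → n ≤? lookup x (upper j))

  upperDivisible-joinExp : ∀ a′ a → UpperDivisible (joinExp a′ a)
  upperDivisible-joinExp a′ a j = subst (n ≤_) (sym (lookup-joinExp-upper a′ a j)) (ℕP.m≤m+n n _)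

  upperDivisible-mono : ∀ {x y} → (∀ p → lookup x p ≤ lookup y p) → UpperDivisible x → UpperDivisible y
  upperDivisible-mono x≤y divisible j = ℕP.≤-trans (divisible j) (x≤y (upper j))

  upperExp : Monomial (n + k) → Monomial k
  upperExp x = tabulate (λ j → lookup x (upper j) ∸ n)

  lowerExp : Monomial (n + k) → Monomial n
  lowerExp x = tabulate (λ j → lookup x (lower j))

  joinExp-split : ∀ {x} → UpperDivisible x → x ≡ joinExp (upperExp x) (lowerExp x)
  joinExp-split {x} divisible = joinExp-ext (upperExp x) (lowerExp x)
    (λ j → trans (sym (ℕP.m+[n∸m]≡n (divisible j))) (cong (n +_) (sym (lookup∘tabulate _ j))))
    (λ j → sym (lookup∘tabulate _ j))

  upperExp-joinExp : ∀ a′ a → upperExp (joinExp a′ a) ≡ a′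
  upperExp-joinExp a′ a = lookup-ext λ j →
    trans (lookup∘tabulate _ j) (trans (cong (_∸ n) (lookup-joinExp-upper a′ a j)) (ℕP.m+n∸m≡n n _))

  lowerExp-joinExp : ∀ a′ a → lowerExp (joinExp a′ a) ≡ a
  lowerExp-joinExp a′ a = lookup-ext λ j → trans (lookup∘tabulate _ j) (lookup-joinExp-lower a′ a j)

  data JoinView : Monomial (n + k) → Set where
    joined       : ∀ a′ a → JoinView (joinExp a′ a)
    notDivisible : ∀ {x} → ¬ UpperDivisible x → JoinView x

  joinView : ∀ x → JoinView x
  joinView x with upperDivisible? x
  ... | yes divisible = subst JoinView (sym (joinExp-split divisible)) (joined (upperExp x) (lowerExp x))
  ... | no ¬divisible = notDivisible ¬divisible

  -- The coefficients of (x₁⋯x_k)ⁿ · f′(x₁,…,x_k) · f(x_{k+1},…,x_{n+k}).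
  blockProduct : Coeffs k → Coeffs n → Coeffs (n + k)
  blockProduct φ′ φ x with upperDivisible? x
  ... | yes _ = φ′ (upperExp x) *ᶻ φ (lowerExp x)
  ... | no _  = 0ℤ

  module _ (φ′ : Coeffs k) (φ : Coeffs n) where

    blockProduct-joinExp : ∀ a′ a → blockProduct φ′ φ (joinExp a′ a) ≡ φ′ a′ *ᶻ φ a
    blockProduct-joinExp a′ a with upperDivisible? (joinExp a′ a)
    ... | yes _         rewrite upperExp-joinExp a′ a | lowerExp-joinExp a′ a = refl
    ... | no ¬divisible = ⊥-elim (¬divisible (upperDivisible-joinExp a′ a))

    blockProduct-notDivisible : ∀ {x} → ¬ UpperDivisible x → blockProduct φ′ φ x ≡ 0ℤ
    blockProduct-notDivisible {x} ¬divisible with upperDivisible? x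
    ... | yes divisible = ⊥-elim (¬divisible divisible)
    ... | no _          = refl

    blockProduct-unique : ∀ (χ : Coeffs (n + k)) → (∀ a′ a → χ (joinExp a′ a) ≡ φ′ a′ *ᶻ φ a) →
                          (∀ {x} → ¬ UpperDivisible x → χ x ≡ 0ℤ) → χ ≗ blockProduct φ′ φ
    blockProduct-unique χ on-joined elsewhere x with joinView x
    ... | joined a′ a = trans (on-joined a′ a) (sym (blockProduct-joinExp a′ a))
    ... | notDivisible ¬divisible = trans (elsewhere ¬divisible) (sym (blockProduct-notDivisible ¬divisible))

  dec-upper-joinExp : ∀ i b′ a → dec (upper i) (joinExp (inc i b′) a) ≡ joinExp b′ a
  dec-upper-joinExp i b′ a = joinExp-ext b′ a at-upper at-lower
    where
    x : Monomial (n + k)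
    x = joinExp (inc i b′) a
    at-upper : ∀ j → lookup (dec (upper i) x) (upper j) ≡ n + lookup b′ j
    at-upper j with j ≟ i
    ... | yes refl = begin
      lookup (dec (upper j) x) (upper j)   ≡⟨ lookup-dec (upper j) x ⟩
      pred (lookup x (upper j))            ≡⟨ cong pred (lookup-joinExp-upper (inc j b′) a j) ⟩
      pred (n + lookup (inc j b′) j)       ≡⟨ cong (λ m → pred (n + m)) (lookup-inc j b′) ⟩
      pred (n + suc (lookup b′ j))         ≡⟨ cong pred (ℕP.+-suc n _) ⟩
      n + lookup b′ j                      ∎
    ... | no j≢i = trans (lookup-dec′ (upper i) (λ eq → j≢i (upper-injective eq)) x)
                         (trans (lookup-joinExp-upper (inc i b′) a j) (cong (n +_) (lookup-inc′ i j≢i b′)))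
    at-lower : ∀ j → lookup (dec (upper i) x) (lower j) ≡ lookup a j
    at-lower j = trans (lookup-dec′ (upper i) (lower≢upper j i) x) (lookup-joinExp-lower (inc i b′) a j)

  dec-lower-joinExp : ∀ i a′ a → dec (lower i) (joinExp a′ a) ≡ joinExp a′ (dec i a)
  dec-lower-joinExp i a′ a = joinExp-ext a′ (dec i a) at-upper at-lower
    where
    x : Monomial (n + k)
    x = joinExp a′ a
    at-upper : ∀ j → lookup (dec (lower i) x) (upper j) ≡ n + lookup a′ j
    at-upper j = trans (lookup-dec′ (lower i) (upper≢lower j i) x) (lookup-joinExp-upper a′ a j)
    at-lower : ∀ j → lookup (dec (lower i) x) (lower j) ≡ lookup (dec i a) j
    at-lower j with j ≟ i
    ... | yes refl = trans (lookup-dec (lower j) x) (trans (cong pred (lookup-joinExp-lower a′ a j)) (sym (lookup-dec j a)))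
    ... | no j≢i = trans (lookup-dec′ (lower i) (λ eq → j≢i (lower-injective eq)) x)
                         (trans (lookup-joinExp-lower a′ a j) (sym (lookup-dec′ i j≢i a)))

  swapExp-upper-joinExp : ∀ i i′ a′ a → swapExp (upper i) (upper i′) (joinExp a′ a) ≡ joinExp (swapExp i i′ a′) a
  swapExp-upper-joinExp i i′ a′ a = joinExp-ext (swapExp i i′ a′) a at-upper at-lower
    where
    x : Monomial (n + k)
    x = joinExp a′ a
    at-upper : ∀ j → lookup (swapExp (upper i) (upper i′) x) (upper j) ≡ n + lookup (swapExp i i′ a′) j
    at-upper j = begin
      lookup (swapExp (upper i) (upper i′) x) (upper j)     ≡⟨ lookup-swapExp (upper i) (upper i′) x (upper j) ⟩
      lookup x (transpose (upper i) (upper i′) (upper j))   ≡⟨ cong (lookup x) (transpose-embed upper upper-injective i i′ j) ⟩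
      lookup x (upper (transpose i i′ j))                   ≡⟨ lookup-joinExp-upper a′ a _ ⟩
      n + lookup a′ (transpose i i′ j)                      ≡⟨ cong (n +_) (lookup-swapExp i i′ a′ j) ⟨
      n + lookup (swapExp i i′ a′) j                        ∎
    at-lower : ∀ j → lookup (swapExp (upper i) (upper i′) x) (lower j) ≡ lookup a j
    at-lower j = trans (lookup-swapExp (upper i) (upper i′) x (lower j))
      (trans (cong (lookup x) (transpose-outside upper i i′ (lower j) (λ j′ → upper≢lower j′ j)))
             (lookup-joinExp-lower a′ a j))

  swapExp-lower-joinExp : ∀ i i′ a′ a → swapExp (lower i) (lower i′) (joinExp a′ a) ≡ joinExp a′ (swapExp i i′ a)
  swapExp-lower-joinExp i i′ a′ a = joinExp-ext a′ (swapExp i i′ a) at-upper at-lower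
    where
    x : Monomial (n + k)
    x = joinExp a′ a
    at-upper : ∀ j → lookup (swapExp (lower i) (lower i′) x) (upper j) ≡ n + lookup a′ j
    at-upper j = trans (lookup-swapExp (lower i) (lower i′) x (upper j))
      (trans (cong (lookup x) (transpose-outside lower i i′ (upper j) (λ j′ → lower≢upper j′ j)))
             (lookup-joinExp-upper a′ a j))
    at-lower : ∀ j → lookup (swapExp (lower i) (lower i′) x) (lower j) ≡ lookup (swapExp i i′ a) j
    at-lower j = begin
      lookup (swapExp (lower i) (lower i′) x) (lower j)     ≡⟨ lookup-swapExp (lower i) (lower i′) x (lower j) ⟩
      lookup x (transpose (lower i) (lower i′) (lower j))   ≡⟨ cong (lookup x) (transpose-embed lower lower-injective i i′ j) ⟩
      lookup x (lower (transpose i i′ j))                   ≡⟨ lookup-joinExp-lower a′ a _ ⟩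
      lookup a (transpose i i′ j)                           ≡⟨ lookup-swapExp i i′ a j ⟨
      lookup (swapExp i i′ a) j                             ∎

  blockProduct-cong : ∀ {φ′ χ′ φ χ} → φ′ ≗ χ′ → φ ≗ χ → blockProduct φ′ φ ≗ blockProduct χ′ χ
  blockProduct-cong φ′≗χ′ φ≗χ x with upperDivisible? x
  ... | yes _ = cong₂ _*ᶻ_ (φ′≗χ′ _) (φ≗χ _)
  ... | no _  = refl

  blockProduct-sub-upper : ∀ φ′ χ′ φ →
    blockProduct (λ y → φ′ y -ᶻ χ′ y) φ ≗ (λ x → blockProduct φ′ φ x -ᶻ blockProduct χ′ φ x)
  blockProduct-sub-upper φ′ χ′ φ x = sym (blockProduct-unique _ φ _
    (λ a′ a → trans (cong₂ _-ᶻ_ (blockProduct-joinExp φ′ φ a′ a) (blockProduct-joinExp χ′ φ a′ a))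
                    (sym (*-distribʳ-sub (φ′ a′) (χ′ a′) (φ a))))
    (λ ¬divisible → cong₂ _-ᶻ_ (blockProduct-notDivisible φ′ φ ¬divisible)
                               (blockProduct-notDivisible χ′ φ ¬divisible)) x)

  blockProduct-sub-lower : ∀ φ′ φ χ →
    blockProduct φ′ (λ y → φ y -ᶻ χ y) ≗ (λ x → blockProduct φ′ φ x -ᶻ blockProduct φ′ χ x)
  blockProduct-sub-lower φ′ φ χ x = sym (blockProduct-unique φ′ _ _
    (λ a′ a → trans (cong₂ _-ᶻ_ (blockProduct-joinExp φ′ φ a′ a) (blockProduct-joinExp φ′ χ a′ a))
                    (sym (*-distribˡ-sub (φ′ a′) (φ a) (χ a))))
    (λ ¬divisible → cong₂ _-ᶻ_ (blockProduct-notDivisible φ′ φ ¬divisible)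
                               (blockProduct-notDivisible φ′ χ ¬divisible)) x)

  xMul-blockProduct-notDivisible : ∀ r φ′ φ {x} → ¬ UpperDivisible x → xMul r (blockProduct φ′ φ) x ≡ 0ℤ
  xMul-blockProduct-notDivisible r φ′ φ {x} ¬divisible =
    trans (cong (whenPositive (lookup x r))
                (blockProduct-notDivisible φ′ φ (λ d → ¬divisible (upperDivisible-mono {dec r x} {x} (lookup-dec-≤ r x) d))))
          (whenPositive-0 (lookup x r))

  module _ (φ′ : Coeffs k) (φ : Coeffs n) (i : Fin k) where

    xMul-upper-vanishes : ∀ {a′} a → lookup a′ i ≡ 0 → xMul (upper i) (blockProduct φ′ φ) (joinExp a′ a) ≡ 0ℤ
    xMul-upper-vanishes {a′} a a′ᵢ≡0 = by-n (n ℕP.≟ 0)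
      where
      x : Monomial (n + k)
      x = joinExp a′ a
      xᵢ≡n : lookup x (upper i) ≡ n
      xᵢ≡n = trans (lookup-joinExp-upper a′ a i) (trans (cong (n +_) a′ᵢ≡0) (ℕP.+-identityʳ n))
      by-n : Dec (n ≡ 0) → xMul (upper i) (blockProduct φ′ φ) x ≡ 0ℤ
      by-n (yes n≡0) = xMul-zero (upper i) (blockProduct φ′ φ) {x} (trans xᵢ≡n n≡0)
      by-n (no n≢0)  = trans (cong (whenPositive (lookup x (upper i))) (blockProduct-notDivisible φ′ φ lowered))
                             (whenPositive-0 _)
        where
        lowered : ¬ UpperDivisible (dec (upper i) x)
        lowered divisible = ℕP.<-irrefl refl (ℕP.m≤pred[n]⇒suc[m]≤n {{≢-nonZero n≢0}}
          (subst (n ≤_) (trans (lookup-dec (upper i) x) (cong pred xᵢ≡n)) (divisible i)))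

    xMul-upper-joinExp : ∀ a′ a → xMul (upper i) (blockProduct φ′ φ) (joinExp a′ a) ≡ xMul i φ′ a′ *ᶻ φ a
    xMul-upper-joinExp a′ a = by-view (incView i a′)
      where
      by-view : ∀ {a′} → IncView i a′ → xMul (upper i) (blockProduct φ′ φ) (joinExp a′ a) ≡ xMul i φ′ a′ *ᶻ φ a
      by-view {a′} (zeroAt a′ᵢ≡0) = trans (xMul-upper-vanishes a a′ᵢ≡0)
        (sym (trans (cong (_*ᶻ φ a) (xMul-zero i φ′ {a′} a′ᵢ≡0)) (ℤP.*-zeroˡ (φ a))))
      by-view (incOf b′) = begin
        xMul (upper i) (blockProduct φ′ φ) (joinExp (inc i b′) a)
          ≡⟨ xMul-suc (upper i) (blockProduct φ′ φ) {joinExp (inc i b′) a}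
               (trans (lookup-joinExp-upper (inc i b′) a i) (trans (cong (n +_) (lookup-inc i b′)) (ℕP.+-suc n _))) ⟩
        blockProduct φ′ φ (dec (upper i) (joinExp (inc i b′) a))  ≡⟨ cong (blockProduct φ′ φ) (dec-upper-joinExp i b′ a) ⟩
        blockProduct φ′ φ (joinExp b′ a)                          ≡⟨ blockProduct-joinExp φ′ φ b′ a ⟩
        φ′ b′ *ᶻ φ a                                              ≡⟨ cong (_*ᶻ φ a) (xMul-inc i φ′ b′) ⟨
        xMul i φ′ (inc i b′) *ᶻ φ a                               ∎

    xMul-upper-blockProduct : xMul (upper i) (blockProduct φ′ φ) ≗ blockProduct (xMul i φ′) φ
    xMul-upper-blockProduct =
      blockProduct-unique (xMul i φ′) φ _ xMul-upper-joinExp (xMul-blockProduct-notDivisible (upper i) φ′ φ)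

  xMul-lower-blockProduct : ∀ φ′ φ i → xMul (lower i) (blockProduct φ′ φ) ≗ blockProduct φ′ (xMul i φ)
  xMul-lower-blockProduct φ′ φ i =
    blockProduct-unique φ′ (xMul i φ) _ on-joined (xMul-blockProduct-notDivisible (lower i) φ′ φ)
    where
    on-joined : ∀ a′ a → xMul (lower i) (blockProduct φ′ φ) (joinExp a′ a) ≡ φ′ a′ *ᶻ xMul i φ a
    on-joined a′ a = begin
      whenPositive (lookup (joinExp a′ a) (lower i)) (blockProduct φ′ φ (dec (lower i) (joinExp a′ a)))
        ≡⟨ cong₂ whenPositive (lookup-joinExp-lower a′ a i)
                              (trans (cong (blockProduct φ′ φ) (dec-lower-joinExp i a′ a))
                                     (blockProduct-joinExp φ′ φ a′ (dec i a))) ⟩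
      whenPositive (lookup a i) (φ′ a′ *ᶻ φ (dec i a))  ≡⟨ whenPositive-* (lookup a i) (φ′ a′) (φ (dec i a)) ⟩
      φ′ a′ *ᶻ xMul i φ a                               ∎

  swap-notDivisible : ∀ (s : Monomial (n + k) → Monomial (n + k)) → (∀ x → s (s x) ≡ x) →
                      (∀ a′ a → UpperDivisible (s (joinExp a′ a))) →
                      ∀ {x} → ¬ UpperDivisible x → ¬ UpperDivisible (s x)
  swap-notDivisible s s-involutive s-joinExp {x} ¬divisible divisible =
    ¬divisible (subst UpperDivisible (s-involutive x)
      (subst (λ y → UpperDivisible (s y)) (sym (joinExp-split divisible)) (s-joinExp (upperExp (s x)) (lowerExp (s x)))))

  swapUpper-blockProduct : ∀ i i′ φ′ φ x →
    blockProduct φ′ φ (swapExp (upper i) (upper i′) x) ≡ blockProduct (λ y → φ′ (swapExp i i′ y)) φ x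
  swapUpper-blockProduct i i′ φ′ φ = blockProduct-unique _ φ _
    (λ a′ a → trans (cong (blockProduct φ′ φ) (swapExp-upper-joinExp i i′ a′ a)) (blockProduct-joinExp φ′ φ (swapExp i i′ a′) a))
    (λ {x} ¬divisible → blockProduct-notDivisible φ′ φ
       (swap-notDivisible (swapExp (upper i) (upper i′)) (swapExp-involutive (upper i) (upper i′))
          (λ a′ a → subst UpperDivisible (sym (swapExp-upper-joinExp i i′ a′ a)) (upperDivisible-joinExp (swapExp i i′ a′) a))
          {x} ¬divisible))

  swapLower-blockProduct : ∀ i i′ φ′ φ x →
    blockProduct φ′ φ (swapExp (lower i) (lower i′) x) ≡ blockProduct φ′ (λ y → φ (swapExp i i′ y)) x
  swapLower-blockProduct i i′ φ′ φ = blockProduct-unique φ′ _ _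
    (λ a′ a → trans (cong (blockProduct φ′ φ) (swapExp-lower-joinExp i i′ a′ a)) (blockProduct-joinExp φ′ φ a′ (swapExp i i′ a)))
    (λ {x} ¬divisible → blockProduct-notDivisible φ′ φ
       (swap-notDivisible (swapExp (lower i) (lower i′)) (swapExp-involutive (lower i) (lower i′))
          (λ a′ a → subst UpperDivisible (sym (swapExp-lower-joinExp i i′ a′ a)) (upperDivisible-joinExp a′ (swapExp i i′ a)))
          {x} ¬divisible))

  upper-intertwines : ∀ φ → Intertwines upper (λ φ′ → blockProduct φ′ φ)
  upper-intertwines φ = record
    { P-cong = λ φ′≗χ′ → blockProduct-cong φ′≗χ′ (λ _ → refl)
    ; P-sub  = λ φ′ χ′ → blockProduct-sub-upper φ′ χ′ φ
    ; P-xMul = λ i φ′ → xMul-upper-blockProduct φ′ φ i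
    ; P-swap = λ i i′ φ′ → swapUpper-blockProduct i i′ φ′ φ
    }

  lower-intertwines : ∀ φ′ → Intertwines lower (blockProduct φ′)
  lower-intertwines φ′ = record
    { P-cong = blockProduct-cong (λ _ → refl)
    ; P-sub  = blockProduct-sub-lower φ′
    ; P-xMul = λ i φ → xMul-lower-blockProduct φ′ φ i
    ; P-swap = λ i i′ φ → swapLower-blockProduct i i′ φ′ φ
    }

swapPositions : ∀ {N} → Fin N → Fin N → Permutation′ N → Permutation′ N
swapPositions i i′ w = Perm.transpose i i′ ∘ₚ w

adjacent⇒≢ : ∀ {N} {i i′ : Fin N} → toℕ i′ ≡ suc (toℕ i) → i ≢ i′
adjacent⇒≢ {i = i} i′≡1+i refl = ℕP.<-irrefl i′≡1+i (ℕP.n<1+n (toℕ i))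

groth-step : ∀ {N} (w : Permutation′ N) {i i′ : Fin N} → toℕ i′ ≡ suc (toℕ i) → w ⟨$⟩ʳ i Fin.< w ⟨$⟩ʳ i′ →
             ∀ {f} → Groth (swapPositions i i′ w) f →
             ∃ λ g → Groth w g × diffMul i i′ (coeff g) ≗ stepNumerator i i′ (coeff f)
groth-step {N} w {i} {i′} i′≡1+i ascent {f} G =
  g , step w (swapPositions i i′ w) i i′ i′≡1+i ascent (λ _ → refl) f g G g-step ,
  stepEquation⇒coeffs i i′ f g g-step
  where
  open DividedDifference i i′ (adjacent⇒≢ i′≡1+i)
  g : Poly N
  g = divDiff ((1ₚ -ₚ X i′) *ₚ f)
  g-step : (X i -ₚ X i′) *ₚ g ≈ₚ ((1ₚ -ₚ X i′) *ₚ f) -ₚ swapVars i i′ ((1ₚ -ₚ X i′) *ₚ f)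
  g-step = divDiff-spec ((1ₚ -ₚ X i′) *ₚ f)

topExp : ∀ N → Monomial N
topExp N = tabulate (λ i → N ∸ suc (toℕ i))

coeff-single : ∀ {N} c (b x : Monomial N) → coeff ((c , b) ∷ []) x ≡ termCoeff c b x
coeff-single c b x = trans (coeff-∷ c b [] x) (ℤP.+-identityʳ _)

module SkewSumGroth (n k : ℕ) where
  open SkewSum n k

  termCoeff-joinExp : ∀ b′ b a′ a → termCoeff 1ℤ (joinExp b′ b) (joinExp a′ a) ≡ termCoeff 1ℤ b′ a′ *ᶻ termCoeff 1ℤ b a
  termCoeff-joinExp b′ b a′ a with ≡-dec ℕP._≟_ (joinExp b′ b) (joinExp a′ a) | ≡-dec ℕP._≟_ b′ a′ | ≡-dec ℕP._≟_ b a
  ... | yes _  | yes _   | yes _   = refl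
  ... | yes eq | no b′≢  | _       = ⊥-elim (b′≢ (proj₁ (joinExp-injective eq)))
  ... | yes eq | yes _   | no b≢   = ⊥-elim (b≢ (proj₂ (joinExp-injective eq)))
  ... | no ≢   | yes b′≡ | yes b≡  = ⊥-elim (≢ (cong₂ joinExp b′≡ b≡))
  ... | no _   | yes _   | no _    = refl
  ... | no _   | no _    | yes _   = refl
  ... | no _   | no _    | no _    = refl

  topExp-skew : topExp (n + k) ≡ joinExp (topExp k) (topExp n)
  topExp-skew = joinExp-ext (topExp k) (topExp n) at-upper at-lower
    where
    at-upper : ∀ j → lookup (topExp (n + k)) (upper j) ≡ n + lookup (topExp k) j
    at-upper j = begin
      lookup (topExp (n + k)) (upper j)   ≡⟨ lookup∘tabulate _ (upper j) ⟩
      (n + k) ∸ suc (toℕ (upper j))       ≡⟨ cong (λ t → (n + k) ∸ suc t) (toℕ-upper j) ⟩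
      (n + k) ∸ suc (toℕ j)               ≡⟨ ℕP.+-∸-assoc n (toℕ<n j) ⟩
      n + (k ∸ suc (toℕ j))               ≡⟨ cong (n +_) (lookup∘tabulate _ j) ⟨
      n + lookup (topExp k) j             ∎
    at-lower : ∀ j → lookup (topExp (n + k)) (lower j) ≡ lookup (topExp n) j
    at-lower j = begin
      lookup (topExp (n + k)) (lower j)   ≡⟨ lookup∘tabulate _ (lower j) ⟩
      (n + k) ∸ suc (toℕ (lower j))       ≡⟨ cong₂ (λ s t → s ∸ suc t) (ℕP.+-comm n k) (toℕ-lower j) ⟩
      (k + n) ∸ suc (k + toℕ j)           ≡⟨ cong ((k + n) ∸_) (ℕP.+-suc k (toℕ j)) ⟨
      (k + n) ∸ (k + suc (toℕ j))         ≡⟨ ℕP.[m+n]∸[m+o]≡n∸o k n (suc (toℕ j)) ⟩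
      n ∸ suc (toℕ j)                     ≡⟨ lookup∘tabulate _ j ⟨
      lookup (topExp n) j                 ∎

  coeff-topMonomial : coeff (topMonomial (n + k)) ≗ blockProduct (coeff (topMonomial k)) (coeff (topMonomial n))
  coeff-topMonomial = blockProduct-unique _ _ _ on-joined elsewhere
    where
    on-joined : ∀ a′ a → coeff (topMonomial (n + k)) (joinExp a′ a) ≡ coeff (topMonomial k) a′ *ᶻ coeff (topMonomial n) a
    on-joined a′ a = begin
      coeff (topMonomial (n + k)) (joinExp a′ a)
        ≡⟨ coeff-single 1ℤ (topExp (n + k)) (joinExp a′ a) ⟩
      termCoeff 1ℤ (topExp (n + k)) (joinExp a′ a)
        ≡⟨ cong (λ b → termCoeff 1ℤ b (joinExp a′ a)) topExp-skew ⟩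
      termCoeff 1ℤ (joinExp (topExp k) (topExp n)) (joinExp a′ a)
        ≡⟨ termCoeff-joinExp (topExp k) (topExp n) a′ a ⟩
      termCoeff 1ℤ (topExp k) a′ *ᶻ termCoeff 1ℤ (topExp n) a
        ≡⟨ cong₂ _*ᶻ_ (coeff-single 1ℤ (topExp k) a′) (coeff-single 1ℤ (topExp n) a) ⟨
      coeff (topMonomial k) a′ *ᶻ coeff (topMonomial n) a
        ∎
    elsewhere : ∀ {x} → ¬ UpperDivisible x → coeff (topMonomial (n + k)) x ≡ 0ℤ
    elsewhere {x} ¬divisible = trans (coeff-single 1ℤ (topExp (n + k)) x) (termCoeff-≢ 1ℤ λ top≡x →
      ¬divisible (subst UpperDivisible (trans (sym topExp-skew) top≡x) (upperDivisible-joinExp (topExp k) (topExp n))))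

  GrothFactors : Permutation′ k → Permutation′ n → Poly (n + k) → Set
  GrothFactors w′ w f″ = ∃₂ λ f′ f → Groth w′ f′ × Groth w f × coeff f″ ≗ blockProduct (coeff f′) (coeff f)

  module _ {w′ w w″} (skew : IsSkewSum w′ w w″) where
    open IsSkewSum skew

    longest-upper : (∀ p → toℕ (w″ ⟨$⟩ʳ p) + toℕ p + 1 ≡ n + k) → ∀ j → toℕ (w′ ⟨$⟩ʳ j) + toℕ j + 1 ≡ k
    longest-upper longest j = ℕP.+-cancelˡ-≡ n _ _ (begin
      n + (toℕ (w′ ⟨$⟩ʳ j) + toℕ j + 1)                    ≡⟨ shuffle (toℕ (w′ ⟨$⟩ʳ j)) (toℕ j) ⟩
      (toℕ (w′ ⟨$⟩ʳ j) + n) + toℕ j + 1                    ≡⟨ cong₂ (λ s t → s + t + 1) (upper-value j) (toℕ-upper j) ⟨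
      toℕ (w″ ⟨$⟩ʳ upper j) + toℕ (upper j) + 1             ≡⟨ longest (upper j) ⟩
      n + k                                                ∎)
      where
      open ℕ-Solver.+-*-Solver using (solve; _:+_; con; _:=_)
      shuffle : ∀ a t → n + (a + t + 1) ≡ (a + n) + t + 1
      shuffle = solve 3 (λ m a t → m :+ (a :+ t :+ con 1) := (a :+ m) :+ t :+ con 1) refl n

    longest-lower : (∀ p → toℕ (w″ ⟨$⟩ʳ p) + toℕ p + 1 ≡ n + k) → ∀ j → toℕ (w ⟨$⟩ʳ j) + toℕ j + 1 ≡ n
    longest-lower longest j = ℕP.+-cancelˡ-≡ k _ _ (begin
      k + (toℕ (w ⟨$⟩ʳ j) + toℕ j + 1)                     ≡⟨ shuffle (toℕ (w ⟨$⟩ʳ j)) (toℕ j) ⟩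
      toℕ (w ⟨$⟩ʳ j) + (k + toℕ j) + 1                     ≡⟨ cong₂ (λ s t → s + t + 1) (lower-value j) (toℕ-lower j) ⟨
      toℕ (w″ ⟨$⟩ʳ lower j) + toℕ (lower j) + 1             ≡⟨ longest (lower j) ⟩
      n + k                                                ≡⟨ ℕP.+-comm n k ⟩
      k + n                                                ∎)
      where
      open ℕ-Solver.+-*-Solver using (solve; _:+_; con; _:=_)
      shuffle : ∀ a t → k + (a + t + 1) ≡ a + (k + t) + 1
      shuffle = solve 3 (λ m a t → m :+ (a :+ t :+ con 1) := a :+ (m :+ t) :+ con 1) refl k

    ascent-upper : ∀ {i i′} → w″ ⟨$⟩ʳ upper i Fin.< w″ ⟨$⟩ʳ upper i′ → w′ ⟨$⟩ʳ i Fin.< w′ ⟨$⟩ʳ i′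
    ascent-upper {i} {i′} ascent = ℕP.+-cancelʳ-< n _ _ (subst₂ _<_ (upper-value i) (upper-value i′) ascent)

    ascent-lower : ∀ {i i′} → w″ ⟨$⟩ʳ lower i Fin.< w″ ⟨$⟩ʳ lower i′ → w ⟨$⟩ʳ i Fin.< w ⟨$⟩ʳ i′
    ascent-lower {i} {i′} ascent = subst₂ _<_ (lower-value i) (lower-value i′) ascent

    no-ascent-upper-lower : ∀ {i i′} → ¬ (w″ ⟨$⟩ʳ upper i Fin.< w″ ⟨$⟩ʳ lower i′)
    no-ascent-upper-lower {i} {i′} ascent = ℕP.<-asym (toℕ<n (w ⟨$⟩ʳ i′))
      (subst (n <_) (lower-value i′) (ℕP.≤-<-trans (subst (n ≤_) (sym (upper-value i)) (ℕP.m≤n+m n _)) ascent))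

    skewSum-swapUpper : ∀ {i i′ v″} → (∀ x → v″ ⟨$⟩ʳ x ≡ w″ ⟨$⟩ʳ transpose (upper i) (upper i′) x) →
                        IsSkewSum (swapPositions i i′ w′) w v″
    skewSum-swapUpper {i} {i′} v″≡ = record
      { upper-value = λ j → trans (cong toℕ (trans (v″≡ (upper j))
                                    (cong (w″ ⟨$⟩ʳ_) (transpose-embed upper upper-injective i i′ j))))
                                  (upper-value (transpose i i′ j))
      ; lower-value = λ j → trans (cong toℕ (trans (v″≡ (lower j))
                                    (cong (w″ ⟨$⟩ʳ_) (transpose-outside upper i i′ (lower j) (λ j′ → upper≢lower j′ j)))))
                                  (lower-value j)
      }

    skewSum-swapLower : ∀ {i i′ v″} → (∀ x → v″ ⟨$⟩ʳ x ≡ w″ ⟨$⟩ʳ transpose (lower i) (lower i′) x) →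
                        IsSkewSum w′ (swapPositions i i′ w) v″
    skewSum-swapLower {i} {i′} v″≡ = record
      { upper-value = λ j → trans (cong toℕ (trans (v″≡ (upper j))
                                    (cong (w″ ⟨$⟩ʳ_) (transpose-outside lower i i′ (upper j) (λ j′ → lower≢upper j′ j)))))
                                  (upper-value j)
      ; lower-value = λ j → trans (cong toℕ (trans (v″≡ (lower j))
                                    (cong (w″ ⟨$⟩ʳ_) (transpose-embed lower lower-injective i i′ j))))
                                  (lower-value (transpose i i′ j))
      }

  -- A step of the recursion for w″ at rows p, p+1 lies in one block: the upper block
  -- carries the larger values, so it cannot ascend into the lower one.
  groth-skewSum : ∀ {w″ f″} → Groth w″ f″ → ∀ {w′ w} → IsSkewSum w′ w w″ → GrothFactors w′ w f″
  groth-skewSum (top w″ longest) skew =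
    topMonomial k , topMonomial n , top _ (longest-upper skew longest) , top _ (longest-lower skew longest) , coeff-topMonomial
  groth-skewSum (step w″ v″ p q q≡1+p ascent v″≡ f g G g-step) {w′} {w} skew with rowView p | rowView q
  ... | inUpper i | inUpper i′
    with groth-skewSum G (skewSum-swapUpper skew v″≡)
  ...   | f′ , f₀ , G′ , G₀ , f≗ with groth-step w′ (adjacent-upper q≡1+p) (ascent-upper skew ascent) G′
  ...     | g′ , G′w , g′-step =
    g′ , f₀ , G′w , G₀ ,
    Intertwines.transport-step (upper-intertwines (coeff f₀)) {i} {i′} (adjacent⇒≢ q≡1+p) {f} {g}
      (stepEquation⇒coeffs (upper i) (upper i′) f g g-step) f≗ g′-step
  groth-skewSum (step w″ v″ p q q≡1+p ascent v″≡ f g G g-step) {w′} {w} skew | inLower i | inLower i′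
    with groth-skewSum G (skewSum-swapLower skew v″≡)
  ...   | f′ , f₀ , G′ , G₀ , f≗ with groth-step w (adjacent-lower q≡1+p) (ascent-lower skew ascent) G₀
  ...     | g₀ , G₀w , g₀-step =
    f′ , g₀ , G′ , G₀w ,
    Intertwines.transport-step (lower-intertwines (coeff f′)) {i} {i′} (adjacent⇒≢ q≡1+p) {f} {g}
      (stepEquation⇒coeffs (lower i) (lower i′) f g g-step) f≗ g₀-step
  groth-skewSum (step _ _ _ _ _ ascent _ _ _ _ _) skew | inUpper _ | inLower _ = ⊥-elim (no-ascent-upper-lower skew ascent)
  groth-skewSum (step _ _ _ _ q≡1+p _ _ _ _ _ _) skew | inLower _ | inUpper _ = ⊥-elim (lower-upper-not-adjacent q≡1+p)

infix 4 _≈ᴰ_ _≈ₜ_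

_≈ᴰ_ : ∀ {N} → Diagram N → Diagram N → Set
D ≈ᴰ E = ∀ r c → D r c ≡ E r c

record _≈ₜ_ {N} (t u : Triple N) : Set where
  constructor ≈ₜ⟨_,_,_⟩
  field
    D≈ : Triple.D t ≈ᴰ Triple.D u
    F≈ : Triple.F t ≈ᴰ Triple.F u
    A≈ : Triple.A t ≈ᴰ Triple.A u

≈ₜ-sym : ∀ {N} {t u : Triple N} → t ≈ₜ u → u ≈ₜ t
≈ₜ-sym ≈ₜ⟨ D≈ , F≈ , A≈ ⟩ = ≈ₜ⟨ (λ r c → sym (D≈ r c)) , (λ r c → sym (F≈ r c)) , (λ r c → sym (A≈ r c)) ⟩

≈ₜ-trans : ∀ {N} {t u v : Triple N} → t ≈ₜ u → u ≈ₜ v → t ≈ₜ v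
≈ₜ-trans ≈ₜ⟨ D≈ , F≈ , A≈ ⟩ ≈ₜ⟨ D≈′ , F≈′ , A≈′ ⟩ =
  ≈ₜ⟨ (λ r c → trans (D≈ r c) (D≈′ r c)) , (λ r c → trans (F≈ r c) (F≈′ r c)) , (λ r c → trans (A≈ r c) (A≈′ r c)) ⟩

Live : ∀ {N} → Triple N → Fin N → Fin N → Set
Live ⟨ D , F , _ ⟩ r c = D r c ≡ true × F r c ≡ false

Shielded : ∀ {N} → Triple N → Fin N → Fin N → Set
Shielded t r c = ∃ λ r′ → r′ Fin.< r × Triple.A t r′ c ≡ true × (∀ r″ → r′ Fin.< r″ → r″ Fin.< r → ¬ Live t r″ c)

isDSD-resp : ∀ {N} {t u : Triple N} → t ≈ₜ u → IsDSD t → IsDSD u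
isDSD-resp {t = ⟨ D , F , A ⟩} {⟨ D′ , F′ , A′ ⟩} ≈ₜ⟨ D≈ , F≈ , A≈ ⟩ (F⊆D , A-live , F-shielded) =
  (λ r c F′rc → trans (sym (D≈ r c)) (F⊆D r c (trans (F≈ r c) F′rc))) ,
  (λ r c A′rc → let (Drc , Frc) = A-live r c (trans (A≈ r c) A′rc)
                in trans (sym (D≈ r c)) Drc , trans (sym (F≈ r c)) Frc) ,
  (λ r c F′rc → let (r′ , r′<r , Ar′c , clear) = F-shielded r c (trans (F≈ r c) F′rc) in
     r′ , r′<r , trans (sym (A≈ r′ c)) Ar′c ,
     λ r″ r′<r″ r″<r (Dr″c , Fr″c) → clear r″ r′<r″ r″<r (trans (D≈ r″ c) Dr″c , trans (F≈ r″ c) Fr″c))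

bubbled : ∀ {N} → Fin N → Fin N → Fin N → Triple N → Triple N
bubbled r s c ⟨ D , F , A ⟩ =
  ⟨ setSq r c true (setSq s c false D) , F , (if A s c then setSq r c true (setSq s c false A) else A) ⟩

kbubbled : ∀ {N} → Fin N → Fin N → Fin N → Triple N → Triple N
kbubbled r s c ⟨ D , F , A ⟩ = ⟨ setSq r c true D , setSq s c true F , setSq r c true (setSq s c false A) ⟩

module _ {N} (r c : Fin N) (b : Bool) where

  setSq-cong : ∀ {D E} → D ≈ᴰ E → setSq r c b D ≈ᴰ setSq r c b E
  setSq-cong D≈E r′ c′ with does (r′ ≟ r) ∧ does (c′ ≟ c)
  ... | true  = refl
  ... | false = D≈E r′ c′

does-≟-embed : ∀ {M N} (e : Fin M → Fin N) → (∀ {a b} → e a ≡ e b → a ≡ b) → ∀ a b → does (e a ≟ e b) ≡ does (a ≟ b)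
does-≟-embed e e-injective a b with a ≟ b
... | yes refl = dec-true (e a ≟ e a) refl
... | no a≢b   = dec-false (e a ≟ e b) (λ eq → a≢b (e-injective eq))

module _ {N} (r c : Fin N) (b : Bool) (D : Diagram N) where

  setSq-other-row : ∀ {r′} → r′ ≢ r → ∀ c′ → setSq r c b D r′ c′ ≡ D r′ c′
  setSq-other-row {r′} r′≢r c′ rewrite dec-false (r′ ≟ r) r′≢r = refl

  setSq-other-col : ∀ r′ {c′} → c′ ≢ c → setSq r c b D r′ c′ ≡ D r′ c′
  setSq-other-col r′ {c′} c′≢c rewrite dec-false (c′ ≟ c) c′≢c | BoolP.∧-zeroʳ (does (r′ ≟ r)) = refl

bubbled-cong : ∀ {N} (r s c : Fin N) {t u} → t ≈ₜ u → bubbled r s c t ≈ₜ bubbled r s c u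
bubbled-cong r s c {⟨ D , F , A ⟩} {⟨ D′ , F′ , A′ ⟩} ≈ₜ⟨ D≈ , F≈ , A≈ ⟩ =
  ≈ₜ⟨ setSq-cong r c true (setSq-cong s c false D≈) , F≈ , A-cong ⟩
  where
  A-cong : (if A s c then setSq r c true (setSq s c false A) else A) ≈ᴰ
           (if A′ s c then setSq r c true (setSq s c false A′) else A′)
  A-cong rewrite A≈ s c with A′ s c
  ... | true  = setSq-cong r c true (setSq-cong s c false A≈)
  ... | false = A≈

kbubbled-cong : ∀ {N} (r s c : Fin N) {t u} → t ≈ₜ u → kbubbled r s c t ≈ₜ kbubbled r s c u
kbubbled-cong r s c ≈ₜ⟨ D≈ , F≈ , A≈ ⟩ =
  ≈ₜ⟨ setSq-cong r c true D≈ , setSq-cong s c true F≈ , setSq-cong r c true (setSq-cong s c false A≈) ⟩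

move-resp : ∀ {N} {t t′ u : Triple N} → Move t t′ → t ≈ₜ u → ∃ λ u′ → Move u u′ × t′ ≈ₜ u′
move-resp {u = ⟨ _ , _ , _ ⟩} (bubble r s c s≡1+r dsd Dsc Fsc Drc) t≈u@(≈ₜ⟨ D≈ , F≈ , _ ⟩) =
  _ , bubble r s c s≡1+r (isDSD-resp t≈u dsd)
        (trans (sym (D≈ s c)) Dsc) (trans (sym (F≈ s c)) Fsc) (trans (sym (D≈ r c)) Drc) ,
  bubbled-cong r s c t≈u
move-resp {u = ⟨ _ , _ , _ ⟩} (kbubble r s c s≡1+r dsd Asc Drc) t≈u@(≈ₜ⟨ D≈ , _ , A≈ ⟩) =
  _ , kbubble r s c s≡1+r (isDSD-resp t≈u dsd) (trans (sym (A≈ s c)) Asc) (trans (sym (D≈ r c)) Drc) ,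
  kbubbled-cong r s c t≈u

move-source-isDSD : ∀ {N} {t t′ : Triple N} → Move t t′ → IsDSD t
move-source-isDSD (bubble _ _ _ _ dsd _ _ _) = dsd
move-source-isDSD (kbubble _ _ _ _ dsd _ _)  = dsd

record CellMap {M N} (row col : Fin M → Fin N) : Set where
  field
    place       : Diagram M → Diagram N
    place-at    : ∀ X r c → place X (row r) (col c) ≡ X r c
    place-setSq : ∀ X r c b → setSq (row r) (col c) b (place X) ≈ᴰ place (setSq r c b X)

  place-setSq₂ : ∀ X r s c → setSq (row r) (col c) true (setSq (row s) (col c) false (place X)) ≈ᴰ
                           place (setSq r c true (setSq s c false X))
  place-setSq₂ X r s c r′ c′ = trans (setSq-cong (row r) (col c) true (place-setSq X s c false) r′ c′)
                                   (place-setSq (setSq s c false X) r c true r′ c′)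

-- A triple of size M placed along `row` and `col` inside triples of size N, so that
-- moves and the dead-square condition within the block are those of the small triple.
record Block (M N : ℕ) : Set where
  field
    row col    : Fin M → Fin N
    row-<      : ∀ {a b} → a Fin.< b → row a Fin.< row b
    row-<⁻¹    : ∀ {a b} → row a Fin.< row b → a Fin.< b
    row-adjacent : ∀ {a b} → toℕ b ≡ suc (toℕ a) → toℕ (row b) ≡ suc (toℕ (row a))
    between    : ∀ {a b r} → row a Fin.< r → r Fin.< row b → ∃ λ j → row j ≡ r
    placeD placeF placeA : CellMap row col
    A-in-block : ∀ X {r c} → CellMap.place placeA X r (col c) ≡ true → ∃ λ j → row j ≡ r

  open CellMap

  embed : Triple M → Triple N
  embed ⟨ D , F , A ⟩ = ⟨ place placeD D , place placeF F , place placeA A ⟩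

  live-embed : ∀ t {r c} → Live t r c → Live (embed t) (row r) (col c)
  live-embed ⟨ D , F , A ⟩ {r} {c} (Drc , Frc) = trans (place-at placeD D r c) Drc , trans (place-at placeF F r c) Frc

  live-restrict : ∀ t {r c} → Live (embed t) (row r) (col c) → Live t r c
  live-restrict ⟨ D , F , A ⟩ {r} {c} (Drc , Frc) =
    trans (sym (place-at placeD D r c)) Drc , trans (sym (place-at placeF F r c)) Frc

  shielded-embed : ∀ t {r c} → Shielded t r c → Shielded (embed t) (row r) (col c)
  shielded-embed t@(⟨ D , F , A ⟩) {r} {c} (r′ , r′<r , Ar′c , clear) =
    row r′ , row-< r′<r , trans (place-at placeA A r′ c) Ar′c , clear′
    where
    clear′ : ∀ r″ → row r′ Fin.< r″ → r″ Fin.< row r → ¬ Live (embed t) r″ (col c)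
    clear′ r″ lo hi live with between lo hi
    ... | j , refl = clear j (row-<⁻¹ lo) (row-<⁻¹ hi) (live-restrict t live)

  shielded-restrict : ∀ t {r c} → Shielded (embed t) (row r) (col c) → Shielded t r c
  shielded-restrict t@(⟨ D , F , A ⟩) {r} {c} (r′ , r′<r , Ar′c , clear) with A-in-block A Ar′c
  ... | j , refl = j , row-<⁻¹ r′<r , trans (sym (place-at placeA A j c)) Ar′c ,
                   λ r″ lo hi live → clear (row r″) (row-< lo) (row-< hi) (live-embed t live)

  isDSD-restrict : ∀ t → IsDSD (embed t) → IsDSD t
  isDSD-restrict t@(⟨ D , F , A ⟩) (F⊆D , A-live , F-shielded) =
    (λ r c Frc → trans (sym (place-at placeD D r c)) (F⊆D (row r) (col c) (trans (place-at placeF F r c) Frc))) ,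
    (λ r c Arc → live-restrict t (A-live (row r) (col c) (trans (place-at placeA A r c) Arc))) ,
    (λ r c Frc → shielded-restrict t (F-shielded (row r) (col c) (trans (place-at placeF F r c) Frc)))

  bubbled-embed : ∀ t r s c → bubbled (row r) (row s) (col c) (embed t) ≈ₜ embed (bubbled r s c t)
  bubbled-embed ⟨ D , F , A ⟩ r s c = ≈ₜ⟨ place-setSq₂ placeD D r s c , (λ _ _ → refl) , A≈ ⟩
    where
    A≈ : (if place placeA A (row s) (col c) then setSq (row r) (col c) true (setSq (row s) (col c) false (place placeA A))
          else place placeA A) ≈ᴰ place placeA (if A s c then setSq r c true (setSq s c false A) else A)
    A≈ rewrite place-at placeA A s c with A s c
    ... | true  = place-setSq₂ placeA A r s c
    ... | false = λ _ _ → refl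

  kbubbled-embed : ∀ t r s c → kbubbled (row r) (row s) (col c) (embed t) ≈ₜ embed (kbubbled r s c t)
  kbubbled-embed ⟨ D , F , A ⟩ r s c =
    ≈ₜ⟨ place-setSq placeD D r c true , place-setSq placeF F s c true , place-setSq₂ placeA A r s c ⟩

  lift-move : ∀ {t t′} → Move t t′ → IsDSD (embed t) → ∃ λ T → Move (embed t) T × T ≈ₜ embed t′
  lift-move {⟨ D , F , A ⟩} (bubble r s c s≡1+r _ Dsc Fsc Drc) dsd =
    _ , bubble (row r) (row s) (col c) (row-adjacent s≡1+r) dsd
          (trans (place-at placeD D s c) Dsc) (trans (place-at placeF F s c) Fsc) (trans (place-at placeD D r c) Drc) ,
    bubbled-embed ⟨ D , F , A ⟩ r s c
  lift-move {⟨ D , F , A ⟩} (kbubble r s c s≡1+r _ Asc Drc) dsd =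
    _ , kbubble (row r) (row s) (col c) (row-adjacent s≡1+r) dsd
          (trans (place-at placeA A s c) Asc) (trans (place-at placeD D r c) Drc) ,
    kbubbled-embed ⟨ D , F , A ⟩ r s c

  lift-star : (∀ {t} → IsDSD t → IsDSD (embed t)) →
              ∀ {t t′} → Star Move t t′ → ∀ {T} → T ≈ₜ embed t → ∃ λ T′ → Star Move T T′ × T′ ≈ₜ embed t′
  lift-star embed-isDSD ε {T} T≈ = T , ε , T≈
  lift-star embed-isDSD (m ◅ ms) T≈
    with lift-move m (embed-isDSD (move-source-isDSD m))
  ... | X , m′ , X≈ with move-resp m′ (≈ₜ-sym T≈)
  ...   | Y , m″ , X≈Y with lift-star embed-isDSD ms (≈ₜ-trans (≈ₜ-sym X≈Y) X≈)
  ...     | T′ , ms′ , T′≈ = T′ , m″ ◅ ms′ , T′≈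

count : ∀ {m} → (Fin m → Bool) → ℕ
count P = sum (List.tabulate (λ c → if P c then 1 else 0))

count-cong : ∀ {m} {P Q : Fin m → Bool} → P ≗ Q → count P ≡ count Q
count-cong P≗Q = cong sum (LP.tabulate-cong λ c → cong (λ b → if b then 1 else 0) (P≗Q c))

count-true : ∀ m → count {m} (λ _ → true) ≡ m
count-true zero    = refl
count-true (suc m) = cong suc (count-true m)

count-false : ∀ m → count {m} (λ _ → false) ≡ 0
count-false zero    = refl
count-false (suc m) = count-false m

count-↑ : ∀ m {k} (P : Fin (m + k) → Bool) → count P ≡ count (λ c → P (c ↑ˡ k)) + count (λ c → P (m ↑ʳ c))
count-↑ zero    P = refl
count-↑ (suc m) P =
  trans (cong ((if P Fin.zero then 1 else 0) +_) (count-↑ m (λ c → P (Fin.suc c))))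
        (sym (ℕP.+-assoc (if P Fin.zero then 1 else 0) _ _))

lookup-wt : ∀ {N} (D : Diagram N) r → lookup (wt D) r ≡ count (D r)
lookup-wt D r = trans (lookup∘tabulate _ r) (cong sum (LP.map-tabulate (λ c → c) (λ c → if D r c then 1 else 0)))

wt-cong : ∀ {N} {D E : Diagram N} → D ≈ᴰ E → wt D ≡ wt E
wt-cong {D = D} {E} D≈E = lookup-ext λ r → trans (lookup-wt D r) (trans (count-cong (D≈E r)) (sym (lookup-wt E r)))

module SkewDiagram (n k : ℕ) where
  open SkewSum n k

  left : Fin n → Fin (n + k)
  left c = c ↑ˡ k

  right : Fin k → Fin (n + k)
  right c = n ↑ʳ c

  left≢right : ∀ a b → left a ≢ right b
  left≢right a b eq with trans (sym (splitAt-↑ˡ n a k)) (trans (cong (splitAt n) eq) (splitAt-↑ʳ n k b))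
  ... | ()

  data ColView : Fin (n + k) → Set where
    inLeft  : ∀ c → ColView (left c)
    inRight : ∀ c → ColView (right c)

  colView : ∀ c → ColView c
  colView c with splitAt n c in eq
  ... | inj₁ c′ = subst ColView (splitAt⁻¹-↑ˡ eq) (inLeft c′)
  ... | inj₂ c′ = subst ColView (splitAt⁻¹-↑ʳ eq) (inRight c′)

  -- [corner | D′] over [D | ∅], with the k × n corner block constant.
  skewᴰ : Bool → Diagram k → Diagram n → Diagram (n + k)
  skewᴰ corner D′ D r c with rowSplit r | splitAt n c
  ... | inj₁ _ | inj₁ _  = corner
  ... | inj₁ j | inj₂ c′ = D′ j c′
  ... | inj₂ j | inj₁ c′ = D j c′
  ... | inj₂ _ | inj₂ _  = false

  skewᴰ-upper-left : ∀ x D′ D j c → skewᴰ x D′ D (upper j) (left c) ≡ x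
  skewᴰ-upper-left x D′ D j c rewrite rowSplit-upper j | splitAt-↑ˡ n c k = refl

  skewᴰ-upper-right : ∀ x D′ D j c → skewᴰ x D′ D (upper j) (right c) ≡ D′ j c
  skewᴰ-upper-right x D′ D j c rewrite rowSplit-upper j | splitAt-↑ʳ n k c = refl

  skewᴰ-lower-left : ∀ x D′ D j c → skewᴰ x D′ D (lower j) (left c) ≡ D j c
  skewᴰ-lower-left x D′ D j c rewrite rowSplit-lower j | splitAt-↑ˡ n c k = refl

  skewᴰ-lower-right : ∀ x D′ D j c → skewᴰ x D′ D (lower j) (right c) ≡ false
  skewᴰ-lower-right x D′ D j c rewrite rowSplit-lower j | splitAt-↑ʳ n k c = refl

  module _ (x : Bool) (D′ : Diagram k) (D : Diagram n) where

    setSq-skew-upper : ∀ r c b → setSq (upper r) (right c) b (skewᴰ x D′ D) ≈ᴰ skewᴰ x (setSq r c b D′) D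
    setSq-skew-upper r c b r₀ c₀ with rowView r₀ | colView c₀
    ... | inUpper j | inRight c′ =
      trans (cong₂ (λ p v → if p then b else v)
                   (cong₂ _∧_ (does-≟-embed upper upper-injective j r) (does-≟-embed right (↑ʳ-injective n _ _) c′ c))
                   (skewᴰ-upper-right x D′ D j c′))
            (sym (skewᴰ-upper-right x (setSq r c b D′) D j c′))
    ... | inUpper j | inLeft c′ =
      trans (setSq-other-col (upper r) (right c) b (skewᴰ x D′ D) (upper j) (λ eq → left≢right c′ c eq))
            (trans (skewᴰ-upper-left x D′ D j c′) (sym (skewᴰ-upper-left x (setSq r c b D′) D j c′)))
    ... | inLower j | inLeft c′ =
      trans (setSq-other-row (upper r) (right c) b (skewᴰ x D′ D) (lower≢upper j r) (left c′))
            (trans (skewᴰ-lower-left x D′ D j c′) (sym (skewᴰ-lower-left x (setSq r c b D′) D j c′)))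
    ... | inLower j | inRight c′ =
      trans (setSq-other-row (upper r) (right c) b (skewᴰ x D′ D) (lower≢upper j r) (right c′))
            (trans (skewᴰ-lower-right x D′ D j c′) (sym (skewᴰ-lower-right x (setSq r c b D′) D j c′)))

    setSq-skew-lower : ∀ r c b → setSq (lower r) (left c) b (skewᴰ x D′ D) ≈ᴰ skewᴰ x D′ (setSq r c b D)
    setSq-skew-lower r c b r₀ c₀ with rowView r₀ | colView c₀
    ... | inLower j | inLeft c′ =
      trans (cong₂ (λ p v → if p then b else v)
                   (cong₂ _∧_ (does-≟-embed lower lower-injective j r) (does-≟-embed left (↑ˡ-injective k _ _) c′ c))
                   (skewᴰ-lower-left x D′ D j c′))
            (sym (skewᴰ-lower-left x D′ (setSq r c b D) j c′))
    ... | inLower j | inRight c′ =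
      trans (setSq-other-col (lower r) (left c) b (skewᴰ x D′ D) (lower j) (λ eq → left≢right c c′ (sym eq)))
            (trans (skewᴰ-lower-right x D′ D j c′) (sym (skewᴰ-lower-right x D′ (setSq r c b D) j c′)))
    ... | inUpper j | inLeft c′ =
      trans (setSq-other-row (lower r) (left c) b (skewᴰ x D′ D) (upper≢lower j r) (left c′))
            (trans (skewᴰ-upper-left x D′ D j c′) (sym (skewᴰ-upper-left x D′ (setSq r c b D) j c′)))
    ... | inUpper j | inRight c′ =
      trans (setSq-other-row (lower r) (left c) b (skewᴰ x D′ D) (upper≢lower j r) (right c′))
            (trans (skewᴰ-upper-right x D′ D j c′) (sym (skewᴰ-upper-right x D′ (setSq r c b D) j c′)))

  skewₜ : Triple k → Triple n → Triple (n + k)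
  skewₜ ⟨ D′ , F′ , A′ ⟩ ⟨ D , F , A ⟩ = ⟨ skewᴰ true D′ D , skewᴰ false F′ F , skewᴰ false A′ A ⟩

  private
    true≢false : true ≢ false
    true≢false ()

  data SkewCell (X : Diagram k) (Y : Diagram n) : Fin (n + k) → Fin (n + k) → Set where
    upperCell : ∀ j c → X j c ≡ true → SkewCell X Y (upper j) (right c)
    lowerCell : ∀ j c → Y j c ≡ true → SkewCell X Y (lower j) (left c)

  skewCell : ∀ {X Y r c} → skewᴰ false X Y r c ≡ true → SkewCell X Y r c
  skewCell {X} {Y} {r} {c} filled with rowView r | colView c
  ... | inUpper j | inRight c′ = upperCell j c′ (trans (sym (skewᴰ-upper-right false X Y j c′)) filled)
  ... | inLower j | inLeft c′  = lowerCell j c′ (trans (sym (skewᴰ-lower-left false X Y j c′)) filled)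
  ... | inUpper j | inLeft c′  = ⊥-elim (true≢false (trans (sym filled) (skewᴰ-upper-left false X Y j c′)))
  ... | inLower j | inRight c′ = ⊥-elim (true≢false (trans (sym filled) (skewᴰ-lower-right false X Y j c′)))

  upperBlock : Triple n → Block k (n + k)
  upperBlock ⟨ D , F , A ⟩ = record
    { row = upper ; col = right
    ; row-< = upper-mono-< ; row-<⁻¹ = upper-cancel-<
    ; row-adjacent = λ {a} {b} b≡1+a → trans (toℕ-upper b) (trans b≡1+a (cong suc (sym (toℕ-upper a))))
    ; between = λ {a} {b} {r} _ r<ub → by-row (rowView r) r<ub
    ; placeD = cellMap true D ; placeF = cellMap false F ; placeA = cellMap false A
    ; A-in-block = λ X {r} {c} filled → in-upper (skewCell filled) (λ c′ eq → left≢right c′ c (sym eq))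
    }
    where
    cellMap : Bool → Diagram n → CellMap upper right
    cellMap x Y = record { place = λ X → skewᴰ x X Y ; place-at = λ X → skewᴰ-upper-right x X Y
                         ; place-setSq = λ X → setSq-skew-upper x X Y }
    by-row : ∀ {r b} → RowView r → r Fin.< upper b → ∃ λ j → upper j ≡ r
    by-row (inUpper j) _ = j , refl
    by-row {b = b} (inLower j) lj<ub = ⊥-elim (ℕP.<-asym lj<ub (upper<lower b j))
    in-upper : ∀ {X Y r c} → SkewCell X Y r c → (∀ c′ → c ≢ left c′) → ∃ λ j → upper j ≡ r
    in-upper (upperCell j _ _) _        = j , refl
    in-upper (lowerCell _ c _) not-left = ⊥-elim (not-left c refl)

  lowerBlock : Triple k → Block n (n + k)
  lowerBlock ⟨ D′ , F′ , A′ ⟩ = record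
    { row = lower ; col = left
    ; row-< = lower-mono-< ; row-<⁻¹ = lower-cancel-<
    ; row-adjacent = λ {a} {b} b≡1+a →
        trans (toℕ-lower b) (trans (cong (k +_) b≡1+a) (trans (ℕP.+-suc k (toℕ a)) (cong suc (sym (toℕ-lower a)))))
    ; between = λ {a} {b} {r} la<r _ → by-row (rowView r) la<r
    ; placeD = cellMap true D′ ; placeF = cellMap false F′ ; placeA = cellMap false A′
    ; A-in-block = λ X {r} {c} filled → in-lower (skewCell filled) (λ c′ eq → left≢right c c′ eq)
    }
    where
    cellMap : Bool → Diagram k → CellMap lower left
    cellMap x Y = record { place = skewᴰ x Y ; place-at = skewᴰ-lower-left x Y ; place-setSq = setSq-skew-lower x Y }
    by-row : ∀ {r a} → RowView r → lower a Fin.< r → ∃ λ j → lower j ≡ r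
    by-row (inLower j) _ = j , refl
    by-row {a = a} (inUpper j) la<uj = ⊥-elim (ℕP.<-asym la<uj (upper<lower j a))
    in-lower : ∀ {X Y r c} → SkewCell X Y r c → (∀ c′ → c ≢ right c′) → ∃ λ j → lower j ≡ r
    in-lower (lowerCell j _ _) _         = j , refl
    in-lower (upperCell _ c _) not-right = ⊥-elim (not-right c refl)

  isDSD-skew : ∀ {t′ t} → IsDSD t′ → IsDSD t → IsDSD (skewₜ t′ t)
  isDSD-skew {t′@(⟨ D′ , F′ , A′ ⟩)} {t@(⟨ D , F , A ⟩)} (F′⊆D′ , A′-live , F′-shielded) (F⊆D , A-live , F-shielded) =
    F″⊆D″ , A″-live , F″-shielded
    where
    F″⊆D″ : ∀ r c → skewᴰ false F′ F r c ≡ true → skewᴰ true D′ D r c ≡ true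
    F″⊆D″ r c filled with skewCell filled
    ... | upperCell j c′ F′jc = trans (skewᴰ-upper-right true D′ D j c′) (F′⊆D′ j c′ F′jc)
    ... | lowerCell j c′ Fjc  = trans (skewᴰ-lower-left true D′ D j c′) (F⊆D j c′ Fjc)
    A″-live : ∀ r c → skewᴰ false A′ A r c ≡ true → Live (skewₜ t′ t) r c
    A″-live r c filled with skewCell filled
    ... | upperCell j c′ A′jc = Block.live-embed (upperBlock t) t′ (A′-live j c′ A′jc)
    ... | lowerCell j c′ Ajc  = Block.live-embed (lowerBlock t′) t (A-live j c′ Ajc)
    F″-shielded : ∀ r c → skewᴰ false F′ F r c ≡ true → Shielded (skewₜ t′ t) r c
    F″-shielded r c filled with skewCell filled
    ... | upperCell j c′ F′jc = Block.shielded-embed (upperBlock t) t′ (F′-shielded j c′ F′jc)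
    ... | lowerCell j c′ Fjc  = Block.shielded-embed (lowerBlock t′) t (F-shielded j c′ Fjc)

  data AdjacentRows : Fin (n + k) → Fin (n + k) → Set where
    bothUpper : ∀ {i j} → toℕ j ≡ suc (toℕ i) → AdjacentRows (upper i) (upper j)
    bothLower : ∀ {i j} → toℕ j ≡ suc (toℕ i) → AdjacentRows (lower i) (lower j)
    straddle  : ∀ i j → AdjacentRows (upper i) (lower j)

  adjacentRows : ∀ {r s} → toℕ s ≡ suc (toℕ r) → AdjacentRows r s
  adjacentRows {r} {s} s≡1+r with rowView r | rowView s
  ... | inUpper i | inUpper j = bothUpper (adjacent-upper s≡1+r)
  ... | inLower i | inLower j = bothLower (adjacent-lower s≡1+r)
  ... | inUpper i | inLower j = straddle i j
  ... | inLower i | inUpper j = ⊥-elim (lower-upper-not-adjacent s≡1+r)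

  MoveInUpper MoveInLower : Triple k → Triple n → Triple (n + k) → Set
  MoveInUpper t′ t X = ∃ λ t′₂ → Move t′ t′₂ × X ≈ₜ skewₜ t′₂ t
  MoveInLower t′ t X = ∃ λ t₂ → Move t t₂ × X ≈ₜ skewₜ t′ t₂

  -- The corner is full in D and empty in F and A, and the lower right block is empty,
  -- so every move stays inside the upper right or the lower left block.
  project-move : ∀ t′ t {X} → Move (skewₜ t′ t) X → MoveInUpper t′ t X ⊎ MoveInLower t′ t X
  project-move t′@(⟨ D′ , F′ , A′ ⟩) t@(⟨ D , F , A ⟩) (bubble r s c s≡1+r dsd Dsc Fsc Drc)
    with adjacentRows s≡1+r | colView c
  ... | bothUpper {i} {j} j≡1+i | inRight c′ =
    inj₁ (_ , bubble i j c′ j≡1+i (Block.isDSD-restrict (upperBlock t) t′ dsd)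
                (trans (sym (skewᴰ-upper-right true D′ D j c′)) Dsc) (trans (sym (skewᴰ-upper-right false F′ F j c′)) Fsc)
                (trans (sym (skewᴰ-upper-right true D′ D i c′)) Drc) ,
          Block.bubbled-embed (upperBlock t) t′ i j c′)
  ... | bothLower {i} {j} j≡1+i | inLeft c′ =
    inj₂ (_ , bubble i j c′ j≡1+i (Block.isDSD-restrict (lowerBlock t′) t dsd)
                (trans (sym (skewᴰ-lower-left true D′ D j c′)) Dsc) (trans (sym (skewᴰ-lower-left false F′ F j c′)) Fsc)
                (trans (sym (skewᴰ-lower-left true D′ D i c′)) Drc) ,
          Block.bubbled-embed (lowerBlock t′) t i j c′)
  ... | bothUpper {i} _ | inLeft c′  = ⊥-elim (true≢false (trans (sym (skewᴰ-upper-left true D′ D i c′)) Drc))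
  ... | straddle i _    | inLeft c′  = ⊥-elim (true≢false (trans (sym (skewᴰ-upper-left true D′ D i c′)) Drc))
  ... | bothLower {j = j} _ | inRight c′ = ⊥-elim (true≢false (trans (sym Dsc) (skewᴰ-lower-right true D′ D j c′)))
  ... | straddle _ j    | inRight c′ = ⊥-elim (true≢false (trans (sym Dsc) (skewᴰ-lower-right true D′ D j c′)))
  project-move t′@(⟨ D′ , F′ , A′ ⟩) t@(⟨ D , F , A ⟩) (kbubble r s c s≡1+r dsd Asc Drc)
    with adjacentRows s≡1+r | colView c
  ... | bothUpper {i} {j} j≡1+i | inRight c′ =
    inj₁ (_ , kbubble i j c′ j≡1+i (Block.isDSD-restrict (upperBlock t) t′ dsd)
                (trans (sym (skewᴰ-upper-right false A′ A j c′)) Asc) (trans (sym (skewᴰ-upper-right true D′ D i c′)) Drc) ,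
          Block.kbubbled-embed (upperBlock t) t′ i j c′)
  ... | bothLower {i} {j} j≡1+i | inLeft c′ =
    inj₂ (_ , kbubble i j c′ j≡1+i (Block.isDSD-restrict (lowerBlock t′) t dsd)
                (trans (sym (skewᴰ-lower-left false A′ A j c′)) Asc) (trans (sym (skewᴰ-lower-left true D′ D i c′)) Drc) ,
          Block.kbubbled-embed (lowerBlock t′) t i j c′)
  ... | bothUpper {j = j} _ | inLeft c′ = ⊥-elim (true≢false (trans (sym Asc) (skewᴰ-upper-left false A′ A j c′)))
  ... | straddle i _    | inLeft c′  = ⊥-elim (true≢false (trans (sym (skewᴰ-upper-left true D′ D i c′)) Drc))
  ... | bothLower {j = j} _ | inRight c′ = ⊥-elim (true≢false (trans (sym Asc) (skewᴰ-lower-right false A′ A j c′)))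
  ... | straddle _ j    | inRight c′ = ⊥-elim (true≢false (trans (sym Asc) (skewᴰ-lower-right false A′ A j c′)))

  project-star : ∀ {T T′} → Star Move T T′ → ∀ {t′ t} → T ≈ₜ skewₜ t′ t →
                 ∃₂ λ t′₁ t₁ → Star Move t′ t′₁ × Star Move t t₁ × T′ ≈ₜ skewₜ t′₁ t₁
  project-star ε {t′} {t} T≈ = t′ , t , ε , ε , T≈
  project-star (m ◅ ms) {t′} {t} T≈ with move-resp m T≈
  ... | X , m′ , T₂≈X with project-move t′ t m′
  ...   | inj₁ (t′₂ , m″ , X≈) with project-star ms (≈ₜ-trans T₂≈X X≈)
  ...     | t′₁ , t₁ , ms′ , ms″ , T′≈ = t′₁ , t₁ , m″ ◅ ms′ , ms″ , T′≈
  project-star (m ◅ ms) {t′} {t} T≈ | X , m′ , T₂≈X | inj₂ (t₂ , m″ , X≈) with project-star ms (≈ₜ-trans T₂≈X X≈)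
  ...     | t′₁ , t₁ , ms′ , ms″ , T′≈ = t′₁ , t₁ , ms′ , m″ ◅ ms″ , T′≈

  lift-stars : ∀ {t′ t′₁ t t₁} → Star Move t′ t′₁ → Star Move t t₁ → IsDSD t → IsDSD t′₁ →
               ∀ {T} → T ≈ₜ skewₜ t′ t → ∃ λ T′ → Star Move T T′ × T′ ≈ₜ skewₜ t′₁ t₁
  lift-stars {t = t} {t₁} ms′ ms dsd dsd′₁ T≈
    with Block.lift-star (upperBlock t) (λ dsd′ → isDSD-skew dsd′ dsd) ms′ T≈
  ... | T₁ , ms₁ , T₁≈ with Block.lift-star (lowerBlock _) (isDSD-skew dsd′₁) ms T₁≈
  ...   | T′ , ms₂ , T′≈ = T′ , ms₁ ◅◅ ms₂ , T′≈


  wt-skew : ∀ D′ D → wt (skewᴰ true D′ D) ≡ joinExp (wt D′) (wt D)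
  wt-skew D′ D = joinExp-ext (wt D′) (wt D) at-upper at-lower
    where
    D″ : Diagram (n + k)
    D″ = skewᴰ true D′ D
    at-upper : ∀ j → lookup (wt D″) (upper j) ≡ n + lookup (wt D′) j
    at-upper j = begin
      lookup (wt D″) (upper j)                 ≡⟨ lookup-wt D″ (upper j) ⟩
      count (D″ (upper j))                     ≡⟨ count-↑ n (D″ (upper j)) ⟩
      count (λ c → D″ (upper j) (left c)) + count (λ c → D″ (upper j) (right c))
        ≡⟨ cong₂ _+_ (count-cong (skewᴰ-upper-left true D′ D j)) (count-cong (skewᴰ-upper-right true D′ D j)) ⟩
      count {n} (λ _ → true) + count (D′ j)    ≡⟨ cong₂ _+_ (count-true n) (sym (lookup-wt D′ j)) ⟩
      n + lookup (wt D′) j                     ∎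
    at-lower : ∀ j → lookup (wt D″) (lower j) ≡ lookup (wt D) j
    at-lower j = begin
      lookup (wt D″) (lower j)                 ≡⟨ lookup-wt D″ (lower j) ⟩
      count (D″ (lower j))                     ≡⟨ count-↑ n (D″ (lower j)) ⟩
      count (λ c → D″ (lower j) (left c)) + count (λ c → D″ (lower j) (right c))
        ≡⟨ cong₂ _+_ (count-cong (skewᴰ-lower-left true D′ D j)) (count-cong (skewᴰ-lower-right true D′ D j)) ⟩
      count (D j) + count {k} (λ _ → false)    ≡⟨ cong₂ _+_ (sym (lookup-wt D j)) (count-false k) ⟩
      lookup (wt D) j + 0                      ≡⟨ ℕP.+-identityʳ _ ⟩
      lookup (wt D) j                          ∎

  skewᴰ-⊆ : ∀ {X X′ Y Y′} x → X ⊆ᴰ X′ → Y ⊆ᴰ Y′ → skewᴰ false X Y ⊆ᴰ skewᴰ x X′ Y′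
  skewᴰ-⊆ {X} {X′} {Y} {Y′} x X⊆X′ Y⊆Y′ r c filled with skewCell filled
  ... | upperCell j c′ Xjc = trans (skewᴰ-upper-right x X′ Y′ j c′) (X⊆X′ j c′ Xjc)
  ... | lowerCell j c′ Yjc = trans (skewᴰ-lower-left x X′ Y′ j c′) (Y⊆Y′ j c′ Yjc)

  skewᴰ-empty : ∅ᴰ ≈ᴰ skewᴰ false ∅ᴰ ∅ᴰ
  skewᴰ-empty r c with skewᴰ false ∅ᴰ ∅ᴰ r c in filled
  ... | false = refl
  ... | true with skewCell filled
  ...   | upperCell _ _ ()
  ...   | lowerCell _ _ ()

⌊⌋-⇔ : ∀ {A B : Set} → (A → B) → (B → A) → (a? : Dec A) (b? : Dec B) → ⌊ a? ⌋ ≡ ⌊ b? ⌋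
⌊⌋-⇔ to from a? b? = trans (isYes≗does a?) (trans (does-⇔ (mk⇔ to from) a? b?) (sym (isYes≗does b?)))

⌊⌋-true : ∀ {A : Set} (a? : Dec A) → A → ⌊ a? ⌋ ≡ true
⌊⌋-true a? a = trans (isYes≗does a?) (dec-true a? a)

⌊⌋-false : ∀ {A : Set} (a? : Dec A) → ¬ A → ⌊ a? ⌋ ≡ false
⌊⌋-false a? ¬a = trans (isYes≗does a?) (dec-false a? ¬a)

module SkewSumRothe {n k} {w′ w w″} (skew : SkewSum.IsSkewSum n k w′ w w″) where
  open SkewSum n k
  open SkewDiagram n k
  open SkewSum.IsSkewSum skew

  inverse-left : ∀ c → w″ ⟨$⟩ˡ left c ≡ lower (w ⟨$⟩ˡ c)
  inverse-left c = trans (cong (w″ ⟨$⟩ˡ_) (sym w″-at)) (Perm.inverseˡ w″)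
    where
    w″-at : w″ ⟨$⟩ʳ lower (w ⟨$⟩ˡ c) ≡ left c
    w″-at = toℕ-injective (trans (lower-value _) (trans (cong toℕ (Perm.inverseʳ w)) (sym (toℕ-↑ˡ c k))))

  inverse-right : ∀ c → w″ ⟨$⟩ˡ right c ≡ upper (w′ ⟨$⟩ˡ c)
  inverse-right c = trans (cong (w″ ⟨$⟩ˡ_) (sym w″-at)) (Perm.inverseˡ w″)
    where
    w″-at : w″ ⟨$⟩ʳ upper (w′ ⟨$⟩ˡ c) ≡ right c
    w″-at = toℕ-injective (trans (upper-value _)
              (trans (cong (λ v → toℕ v + n) (Perm.inverseʳ w′)) (trans (ℕP.+-comm _ n) (sym (toℕ-↑ʳ n c)))))

  rothe-skew : Rothe w″ ≈ᴰ skewᴰ true (Rothe w′) (Rothe w)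
  rothe-skew r c with rowView r | colView c
  ... | inUpper j | inLeft c′ = trans
    (cong₂ _∧_ (⌊⌋-true (upper j <? w″ ⟨$⟩ˡ left c′) (subst (upper j Fin.<_) (sym (inverse-left c′)) (upper<lower j _)))
               (⌊⌋-true (left c′ <? w″ ⟨$⟩ʳ upper j) left<upper-value))
    (sym (skewᴰ-upper-left true (Rothe w′) (Rothe w) j c′))
    where
    left<upper-value : left c′ Fin.< w″ ⟨$⟩ʳ upper j
    left<upper-value = subst₂ _<_ (sym (toℕ-↑ˡ c′ k)) (sym (upper-value j)) (ℕP.<-≤-trans (toℕ<n c′) (ℕP.m≤n+m n _))
  ... | inUpper j | inRight c′ = trans
    (cong₂ _∧_ (⌊⌋-⇔ (λ lt → upper-cancel-< (subst (upper j Fin.<_) (inverse-right c′) lt))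
                     (λ lt → subst (upper j Fin.<_) (sym (inverse-right c′)) (upper-mono-< lt))
                     (upper j <? w″ ⟨$⟩ˡ right c′) (j <? w′ ⟨$⟩ˡ c′))
               (⌊⌋-⇔ (λ lt → ℕP.+-cancelˡ-< n _ _ (subst₂ _<_ (toℕ-↑ʳ n c′) w″-value lt))
                     (λ lt → subst₂ _<_ (sym (toℕ-↑ʳ n c′)) (sym w″-value) (ℕP.+-monoʳ-< n lt))
                     (right c′ <? w″ ⟨$⟩ʳ upper j) (c′ <? w′ ⟨$⟩ʳ j)))
    (sym (skewᴰ-upper-right true (Rothe w′) (Rothe w) j c′))
    where
    w″-value : toℕ (w″ ⟨$⟩ʳ upper j) ≡ n + toℕ (w′ ⟨$⟩ʳ j)
    w″-value = trans (upper-value j) (ℕP.+-comm _ n)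
  ... | inLower j | inLeft c′ = trans
    (cong₂ _∧_ (⌊⌋-⇔ (λ lt → lower-cancel-< (subst (lower j Fin.<_) (inverse-left c′) lt))
                     (λ lt → subst (lower j Fin.<_) (sym (inverse-left c′)) (lower-mono-< lt))
                     (lower j <? w″ ⟨$⟩ˡ left c′) (j <? w ⟨$⟩ˡ c′))
               (⌊⌋-⇔ (subst₂ _<_ (toℕ-↑ˡ c′ k) (lower-value j)) (subst₂ _<_ (sym (toℕ-↑ˡ c′ k)) (sym (lower-value j)))
                     (left c′ <? w″ ⟨$⟩ʳ lower j) (c′ <? w ⟨$⟩ʳ j)))
    (sym (skewᴰ-lower-left true (Rothe w′) (Rothe w) j c′))
  ... | inLower j | inRight c′ = trans
    (trans (cong (⌊ lower j <? w″ ⟨$⟩ˡ right c′ ⌋ ∧_) (⌊⌋-false (right c′ <? w″ ⟨$⟩ʳ lower j) right≮lower-value))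
           (BoolP.∧-zeroʳ _))
    (sym (skewᴰ-lower-right true (Rothe w′) (Rothe w) j c′))
    where
    right≮lower-value : ¬ (right c′ Fin.< w″ ⟨$⟩ʳ lower j)
    right≮lower-value lt = ℕP.<-asym (toℕ<n (w ⟨$⟩ʳ j))
      (ℕP.≤-<-trans (subst (n ≤_) (sym (toℕ-↑ʳ n c′)) (ℕP.m≤m+n n _)) (subst (toℕ (right c′) <_) (lower-value j) lt))

SBDWeight : ∀ {N} → Triple N → Monomial N → Set
SBDWeight t a = ∃ λ t′ → (t′ ∈SBD t) × wt (Triple.D t′) ≡ a

suppGrothIs-resp : ∀ {N} {w : Permutation′ N} {S T : Monomial N → Set} → (∀ a → S a ⇔ T a) →
                   SuppGrothIs w S → SuppGrothIs w T
suppGrothIs-resp S⇔T supp f G a = mk⇔ (λ nz → Equivalence.to (S⇔T a) (Equivalence.to (supp f G a) nz))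
                                      (λ Ta → Equivalence.from (supp f G a) (Equivalence.from (S⇔T a) Ta))

module SkewSumSupport (n k : ℕ) where
  open SkewSum n k
  open SkewSumGroth n k
  open SkewDiagram n k

  JoinedFrom : (Monomial k → Set) → (Monomial n → Set) → Monomial (n + k) → Set
  JoinedFrom S′ S x = ∃₂ λ a′ a → S′ a′ × S a × joinExp a′ a ≡ x

  suppGroth-skew : ∀ {w′ w w″ S′ S} → IsSkewSum w′ w w″ → SuppGrothIs w′ S′ → SuppGrothIs w S →
                   SuppGrothIs w″ (JoinedFrom S′ S)
  suppGroth-skew {S′ = S′} {S} skew supp′ supp f″ G″ x with groth-skewSum G″ skew
  ... | f′ , f , G′ , G , f″≗ = mk⇔ (to (joinView x)) from
    where
    coeff-joinExp : ∀ a′ a → coeff f″ (joinExp a′ a) ≡ coeff f′ a′ *ᶻ coeff f a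
    coeff-joinExp a′ a = trans (f″≗ (joinExp a′ a)) (blockProduct-joinExp (coeff f′) (coeff f) a′ a)
    to : ∀ {x} → JoinView x → coeff f″ x ≢ 0ℤ → JoinedFrom S′ S x
    to (notDivisible ¬divisible) nz = ⊥-elim (nz (trans (f″≗ _) (blockProduct-notDivisible _ _ ¬divisible)))
    to (joined a′ a) nz = a′ , a , Equivalence.to (supp′ f′ G′ a′) f′≢0 , Equivalence.to (supp f G a) f≢0 , refl
      where
      f′≢0 : coeff f′ a′ ≢ 0ℤ
      f′≢0 z = nz (trans (coeff-joinExp a′ a) (trans (cong (_*ᶻ coeff f a) z) (ℤP.*-zeroˡ (coeff f a))))
      f≢0 : coeff f a ≢ 0ℤ
      f≢0 z = nz (trans (coeff-joinExp a′ a) (trans (cong (coeff f′ a′ *ᶻ_) z) (ℤP.*-zeroʳ (coeff f′ a′))))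
    from : JoinedFrom S′ S x → coeff f″ x ≢ 0ℤ
    from (a′ , a , Sa′ , Sa , refl) z with ℤP.i*j≡0⇒i≡0∨j≡0 (coeff f′ a′) (trans (sym (coeff-joinExp a′ a)) z)
    ... | inj₁ z′ = Equivalence.from (supp′ f′ G′ a′) Sa′ z′
    ... | inj₂ z₀ = Equivalence.from (supp f G a) Sa z₀

  module _ {T₀ t′₀ t₀} (T₀≈ : T₀ ≈ₜ skewₜ t′₀ t₀) (dsd₀ : IsDSD t₀) where

    sbdWeight-split : ∀ {x} → SBDWeight T₀ x → JoinedFrom (SBDWeight t′₀) (SBDWeight t₀) x
    sbdWeight-split (T , (steps , dsd) , refl) with project-star steps T₀≈
    ... | t′₁ , t₁ , steps′ , steps₀ , T≈ =
      wt (Triple.D t′₁) , wt (Triple.D t₁) ,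
      (t′₁ , (steps′ , Block.isDSD-restrict (upperBlock t₁) t′₁ dsd₁) , refl) ,
      (t₁ , (steps₀ , Block.isDSD-restrict (lowerBlock t′₁) t₁ dsd₁) , refl) ,
      sym (trans (wt-cong (_≈ₜ_.D≈ T≈)) (wt-skew (Triple.D t′₁) (Triple.D t₁)))
      where
      dsd₁ : IsDSD (skewₜ t′₁ t₁)
      dsd₁ = isDSD-resp T≈ dsd

    sbdWeight-join : ∀ {x} → JoinedFrom (SBDWeight t′₀) (SBDWeight t₀) x → SBDWeight T₀ x
    sbdWeight-join (_ , _ , (t′₁ , (steps′ , dsd′₁) , refl) , (t₁ , (steps₀ , dsd₁) , refl) , refl)
      with lift-stars steps′ steps₀ dsd₀ dsd′₁ T₀≈
    ... | T , steps , T≈ =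
      T , (steps , isDSD-resp (≈ₜ-sym T≈) (isDSD-skew dsd′₁ dsd₁)) ,
      trans (wt-cong (_≈ₜ_.D≈ T≈)) (wt-skew (Triple.D t′₁) (Triple.D t₁))

initial-isDSD : ∀ {N} {D A : Diagram N} → A ⊆ᴰ D → IsDSD ⟨ D , ∅ᴰ , A ⟩
initial-isDSD A⊆D = (λ _ _ ()) , (λ r c Arc → A⊆D r c Arc , refl) , (λ _ _ ())

corollary5p8 :
  (n k : ℕ) (w : Permutation′ n) (w' : Permutation′ k) (w'' : Permutation′ (n + k)) →
  (∀ (j : Fin k) (p : Fin (n + k)) → toℕ p ≡ toℕ j →
     toℕ (w'' ⟨$⟩ʳ p) ≡ toℕ (w' ⟨$⟩ʳ j) + n) →
  (∀ (j : Fin n) (p : Fin (n + k)) → toℕ p ≡ k + toℕ j →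
     toℕ (w'' ⟨$⟩ʳ p) ≡ toℕ (w ⟨$⟩ʳ j)) →
  (A : Diagram n) → A ⊆ᴰ Rothe w → SuppViaSBD w A →
  (A' : Diagram k) → A' ⊆ᴰ Rothe w' → SuppViaSBD w' A' →
  ∃ λ (A'' : Diagram (n + k)) → A'' ⊆ᴰ Rothe w'' × SuppViaSBD w'' A''
corollary5p8 n k w w′ w″ upper-values lower-values A A⊆D suppA A′ A′⊆D′ suppA′ =
  skewᴰ false A′ A ,
  (λ r c A″rc → trans (rothe-skew r c) (skewᴰ-⊆ true A′⊆D′ A⊆D r c A″rc)) ,
  suppGrothIs-resp (λ _ → mk⇔ (sbdWeight-join T₀≈ (initial-isDSD A⊆D)) (sbdWeight-split T₀≈ (initial-isDSD A⊆D)))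
                   (suppGroth-skew skew suppA′ suppA)
  where
  open SkewSum n k
  open SkewSumGroth n k
  open SkewDiagram n k
  open SkewSumSupport n k

  skew : IsSkewSum w′ w w″
  skew = record { upper-value = λ j → upper-values j (upper j) (toℕ-upper j)
                ; lower-value = λ j → lower-values j (lower j) (toℕ-lower j) }

  open SkewSumRothe skew

  T₀≈ : ⟨ Rothe w″ , ∅ᴰ , skewᴰ false A′ A ⟩ ≈ₜ skewₜ ⟨ Rothe w′ , ∅ᴰ , A′ ⟩ ⟨ Rothe w , ∅ᴰ , A ⟩
  T₀≈ = ≈ₜ⟨ rothe-skew , skewᴰ-empty , (λ _ _ → refl) ⟩
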